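{- Let $a_1,d$ be positive integers and let $n>a_1+d$. For every integer $l>0$, the number of primitive periodic orbits of length $l$ on the directed circulant graph $C_n^+(a_1,a_1+d)$ is \[ PO(n,l,a_1,d)=\frac{n}{l}\sum_{m=\lceil a_1 l/n\rceil}^{\lfloor (d+a_1)l/n\rfloor}\ \sum_{\omega\mid m,\ \omega\mid l}\mu(\omega)\binom{l/\omega}{\frac{mn-a_1l}{\omega d}}, \] where the inner sum runs over positive integers $\omega$ dividing both $m$ and $l$.
   Context: $C_n^+(a_1,a_1+d)$ is the directed graph with vertex set $\{0,1,\dots,n-1\}$ (identified with $\mathbb{Z}/n\mathbb{Z}$) whose bonds (directed edges) are $(v, v+a_1 \bmod n)$ and $(v, v+a_1+d \bmod n)$ for every vertex $v$. A walk of length $l$ is a sequence of vertices $v_0,v_1,\dots,v_l$ with each $(v_i,v_{i+1})$ a bond; a circuit is a walk of positive length with $v_l=v_0$. A periodic orbit is an equivalence class of circuits under cyclic rotation; its length is the length of any circuit in it. A circuit (periodic orbit) is primitive if it is not a shorter circuit (periodic orbit) repeated several times. $\mu$ is the Möbius function: $\mu(1)=1$, $\mu(\omega)=0$ if $\omega$ is divisible by the square of a prime, and $\mu(\omega)=(-1)^k$ if $\omega$ is a product of $k$ distinct primes. Convention: a binomial coefficient $\binom{a}{b}$ is taken to be $0$ unless $a,b$ are integers with $0\le b\le a$ (in particular it is $0$ when the lower index is not an integer). -}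

module Defs where

open import Data.Bool using (Bool; true; false; if_then_else_; _∧_)
open import Data.Rational as ℚ using (ℚ)
open import Data.Nat as ℕ using (ℕ; zero; suc; _+_; _*_; _∸_; _≤_; _<_; NonZero; _≤ᵇ_)
open import Data.Nat.DivMod using (_/_; _%_)
open import Data.Nat.Divisibility using (_∣_; _∣?_)
open import Data.Nat.Combinatorics using (_C_)
open import Data.Integer as ℤ using (ℤ; +_)
open import Data.Fin using (Fin; toℕ)
open import Data.List using (List; []; _∷_; _++_; _∷ʳ_; length; concat; replicate; take; head; last; applyUpTo; foldr)
open import Data.List.Relation.Unary.Linked using (Linked)
open import Data.Maybe using (Maybe)
open import Data.Product using (Σ; _×_)
open import Data.Sum using (_⊎_)
open import Relation.Nullary using (¬_; does)
open import Relation.Binary.PropositionalEquality using (_≡_)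

nz : ∀ a₁ d {n} → a₁ + d < n → NonZero n
nz a₁ d {suc n} _ = _

Bond : (n a₁ d : ℕ) → .{{NonZero n}} → Fin n → Fin n → Set
Bond n a₁ d u v = toℕ v ≡ (toℕ u + a₁) % n ⊎ toℕ v ≡ (toℕ u + (a₁ + d)) % n

-- A walk of length l is the list of its l+1 vertices v₀,…,v_l,
-- consecutive ones joined by bonds.  A circuit has positive length and v_l = v₀.
Circuit : (n a₁ d : ℕ) → .{{NonZero n}} → (l : ℕ) → List (Fin n) → Set
Circuit n a₁ d l vs =
  (0 < l) × (length vs ≡ suc l) × Linked (Bond n a₁ d) vs × (head vs ≡ last vs)

-- cyclic rotation of a circuit v₀ v₁ … v_l (= v₀)  ↦  v₁ … v_l v₁
rot : {A : Set} → List A → List A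
rot (x ∷ y ∷ ys) = (y ∷ ys) ∷ʳ y
rot xs = xs

rot^ : {A : Set} → ℕ → List A → List A
rot^ zero xs = xs
rot^ (suc k) xs = rot (rot^ k xs)

RotEquiv : {A : Set} → List A → List A → Set
RotEquiv c c' = Σ ℕ λ k → rot^ k c ≡ c'

dropLast : {A : Set} → List A → List A
dropLast [] = []
dropLast (x ∷ []) = []
dropLast (x ∷ y ∷ ys) = x ∷ dropLast (y ∷ ys)

repeatCircuit : {A : Set} → ℕ → List A → List A
repeatCircuit m w = concat (replicate m (dropLast w)) ++ take 1 w

Primitive : (n a₁ d : ℕ) → .{{NonZero n}} → (l : ℕ) → List (Fin n) → Set
Primitive n a₁ d l vs =
  ¬ (Σ ℕ λ k → Σ ℕ λ m → Σ (List (Fin n)) λ w →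
       Circuit n a₁ d k w × k < l × vs ≡ repeatCircuit m w)

PrimCircuit : (n a₁ d : ℕ) → .{{NonZero n}} → (l : ℕ) → Set
PrimCircuit n a₁ d l =
  Σ (List (Fin n)) λ vs → Circuit n a₁ d l vs × Primitive n a₁ d l vs

_≈PO_ : ∀ {n a₁ d l} .{{_ : NonZero n}} → PrimCircuit n a₁ d l → PrimCircuit n a₁ d l → Set
c ≈PO c' = RotEquiv (Σ.proj₁ c) (Σ.proj₁ c')

-- "A has exactly N classes under ~": a bijection between Fin N and A/~
record HasClassCount {A : Set} (_~_ : A → A → Set) (N : ℕ) : Set where
  field
    to       : Fin N → A
    from     : A → Fin N
    from-resp : ∀ {x y} → x ~ y → from x ≡ from y
    from-to  : ∀ i → from (to i) ≡ i
    to-from  : ∀ x → to (from x) ~ x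

NumPrimOrbits : (n a₁ d : ℕ) → .{{NonZero n}} → (l N : ℕ) → Set
NumPrimOrbits n a₁ d l N = HasClassCount (_≈PO_ {n} {a₁} {d} {l}) N

-- Möbius function, by trial division: mobius-go fuel k p  with p = q + 2
-- the current trial divisor; the first divisor found is the least prime factor.
mobius-go : ℕ → ℕ → ℕ → ℤ
mobius-go zero k q = + 1
mobius-go (suc f) k q =
  if k ≤ᵇ 1 then + 1
  else if does ((2 + q) ∣? k)
       then (if does ((2 + q) * (2 + q) ∣? k) then + 0
             else ℤ.- mobius-go f (k / (2 + q)) (suc q))
       else mobius-go f k (suc q)

μ : ℕ → ℤ
μ k = mobius-go (2 * k + 2) k 0

-- generalised binomial  (a choose (num/den))  with num, den natural numbers:
-- 0 unless num/den is an integer b with 0 ≤ b ≤ a  (_C_ is 0 when b > a)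
binomFrac : (a num den : ℕ) → ℕ
binomFrac a num zero = 0
binomFrac a num (suc e) = if does (suc e ∣? num) then a C (num / suc e) else 0

-- Σ_{i = lo}^{hi} f i   (empty if hi < lo)
sumRange : ℕ → ℕ → (ℕ → ℤ) → ℤ
sumRange lo hi f = foldr ℤ._+_ (+ 0) (applyUpTo (λ i → f (lo + i)) (suc hi ∸ lo))

-- Σ over positive ω with ω ∣ m and ω ∣ l  (such ω lie in 1..l since l > 0)
-- of  μ(ω) · binom(l/ω, (m n − a₁ l)/(ω d))
innerSum : (n l a₁ d m : ℕ) → ℤ
innerSum n l a₁ d m = sumRange 1 l term
  where
  term : ℕ → ℤ
  term zero = + 0
  term (suc i) =
    if does (suc i ∣? m) ∧ does (suc i ∣? l)
    then μ (suc i) ℤ.* + binomFrac (l / suc i) (m * n ∸ a₁ * l) (suc i * d)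
    else + 0

ceilDiv : (x n : ℕ) → .{{NonZero n}} → ℕ
ceilDiv x n = (x + (n ∸ 1)) / n

POformula : (n l a₁ d : ℕ) → .{{NonZero n}} → .{{NonZero l}} → ℚ
POformula n l a₁ d =
  (+ n ℚ./ l) ℚ.* (sumRange (ceilDiv (a₁ * l) n) (((d + a₁) * l) / n) (innerSum n l a₁ d) ℚ./ 1)

-- A primitive periodic orbit of length l is a rotation class of aperiodic cyclic words
-- v₀ … v_{l-1} that are closed walks, and every such class has exactly l members; so
-- l · PO is the number of aperiodic closed words of length l.  Möbius inversion over the
-- periods of a word turns this into ∑_{ω ∣ l} μ(ω) · #(closed words of length l/ω).  A
-- closed walk of length k with j steps of length a₁ + d starts at any of the n vertices,
-- in k C j orders, exactly when n ∣ k a₁ + j d.  Writing k a₁ + j d = m n with k = l/ω and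
-- exchanging the sums over ω and m gives the formula.
module Submission where

open import Data.Bool using (if_then_else_; _∧_)
open import Data.Empty using (⊥; ⊥-elim)
open import Data.Fin as Fin using (Fin; toℕ) renaming (zero to fzero; suc to fsuc)
import Data.Fin.Properties as FinP
open import Data.Integer using (ℤ; +_; -_) renaming (_+_ to _+ᶻ_; _*_ to _*ᶻ_)
import Data.Integer.Properties as ℤP
open import Data.List using (List; []; _∷_; _++_; [_]; length; take; drop; map; concatMap; concat; replicate; last; lookup; foldr; applyUpTo; allFin; tabulate; filter; find)
import Data.List.Properties as LP
open import Data.List.Membership.Propositional using (_∈_)
import Data.List.Membership.Propositional.Properties as MemP
open import Data.List.Relation.Unary.Any as Any using (here; there; index)
import Data.List.Relation.Unary.Any.Properties as AnyP
open import Data.List.Relation.Unary.Linked using (Linked; [-]; _∷_)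
open import Data.Maybe using (Maybe; just)
import Data.Maybe.Properties as MP
open import Data.Nat as ℕ using (ℕ; zero; suc; _≤_; _<_; z≤n; s≤s; _+_; _*_; _∸_; NonZero)
import Data.Nat.Properties as ℕP
open import Data.Nat.Combinatorics using (_C_)
import Data.Nat.Combinatorics as ℕC
open import Data.Nat.Coprimality using (Coprime; coprime-divisor)
open import Data.Nat.Divisibility using (_∣_; divides; _∣?_)
import Data.Nat.Divisibility as ℕD
open import Data.Nat.DivMod using (_/_; _%_)
import Data.Nat.DivMod as ℕDM
open import Data.Product using (Σ; _×_; _,_; proj₁; proj₂)
open import Data.Sum using (inj₁; inj₂; [_,_]′)
import Data.Rational as ℚ
import Data.Rational.Properties as ℚP
open import Data.Rational.Unnormalised using (mkℚᵘ; *≡*)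
import Data.Rational.Unnormalised.Properties as ℚᵘP
open import Function using (_∘_)
open import Relation.Binary.Definitions using (DecidableEquality; tri<; tri≈; tri>)
open import Relation.Binary.PropositionalEquality hiding ([_])
open import Relation.Nullary using (Dec; yes; no; ¬_; does)
open import Relation.Nullary.Decidable using (_×-dec_; _⊎-dec_; ¬?)
open import Relation.Unary using (Decidable)

open import Defs

open import Algebra.Properties.CommutativeSemigroup ℤP.+-commutativeSemigroup
  using () renaming (interchange to +-interchange; x∙yz≈xz∙y to x+[y+z]≡[x+z]+y)
open import Algebra.Properties.CommutativeSemigroup ℤP.*-commutativeSemigroup
  using () renaming (x∙yz≈y∙xz to x*[y*z]≡y*[x*z])
import Data.Nat.Solver as ℕSolver

private
  variable
    A B : Set

𝟙 : {P : Set} → Dec P → ℤ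
𝟙 (yes _) = + 1
𝟙 (no _) = + 0

𝟙-yes : {P : Set} (p? : Dec P) → P → 𝟙 p? ≡ + 1
𝟙-yes (yes _) p = refl
𝟙-yes (no ¬p) p = ⊥-elim (¬p p)

𝟙-no : {P : Set} (p? : Dec P) → ¬ P → 𝟙 p? ≡ + 0
𝟙-no (yes p) ¬p = ⊥-elim (¬p p)
𝟙-no (no _) ¬p = refl

𝟙-cong : {P Q : Set} (p? : Dec P) (q? : Dec Q) → (P → Q) → (Q → P) → 𝟙 p? ≡ 𝟙 q?
𝟙-cong (yes p) (yes q) f g = refl
𝟙-cong (yes p) (no ¬q) f g = ⊥-elim (¬q (f p))
𝟙-cong (no ¬p) (yes q) f g = ⊥-elim (¬p (g q))
𝟙-cong (no ¬p) (no ¬q) f g = refl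

𝟙-× : {P Q : Set} (p? : Dec P) (q? : Dec Q) → 𝟙 (p? ×-dec q?) ≡ 𝟙 p? *ᶻ 𝟙 q?
𝟙-× (yes _) (yes _) = refl
𝟙-× (yes _) (no _) = refl
𝟙-× (no _) (yes _) = refl
𝟙-× (no _) (no _) = refl

𝟙-⊎ : {P Q : Set} (p? : Dec P) (q? : Dec Q) → (P → Q → ⊥) → 𝟙 (p? ⊎-dec q?) ≡ 𝟙 p? +ᶻ 𝟙 q?
𝟙-⊎ (yes p) (yes q) disjoint = ⊥-elim (disjoint p q)
𝟙-⊎ (yes _) (no _) disjoint = refl
𝟙-⊎ (no _) (yes _) disjoint = refl
𝟙-⊎ (no _) (no _) disjoint = refl

if-yes : {P A : Set} (p? : Dec P) {a b : A} → P → (if does p? then a else b) ≡ a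
if-yes (yes _) p = refl
if-yes (no ¬p) p = ⊥-elim (¬p p)

if-no : {P A : Set} (p? : Dec P) {a b : A} → ¬ P → (if does p? then a else b) ≡ b
if-no (yes p) ¬p = ⊥-elim (¬p p)
if-no (no _) ¬p = refl

if-∧-else-0 : {P Q : Set} (p? : Dec P) (q? : Dec Q) (x : ℤ) →
  (if does p? ∧ does q? then x else + 0) ≡ 𝟙 p? *ᶻ (𝟙 q? *ᶻ x)
if-∧-else-0 (yes _) (yes _) x = sym (trans (ℤP.*-identityˡ _) (ℤP.*-identityˡ x))
if-∧-else-0 (yes _) (no _) x = refl
if-∧-else-0 (no _) q? x = refl

if-else-0 : {P : Set} (p? : Dec P) (x : ℕ) → + (if does p? then x else 0) ≡ 𝟙 p? *ᶻ + x
if-else-0 (yes _) x = sym (ℤP.*-identityˡ (+ x))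
if-else-0 (no _) x = refl

if-else-0-cong : {P Q : Set} (p? : Dec P) (q? : Dec Q) {x y : ℕ} → (P → Q) → (Q → P) → x ≡ y →
  (if does p? then x else 0) ≡ (if does q? then y else 0)
if-else-0-cong (yes _) (yes _) f g e = e
if-else-0-cong (yes p) (no ¬q) f g e = ⊥-elim (¬q (f p))
if-else-0-cong (no ¬p) (yes q) f g e = ⊥-elim (¬p (g q))
if-else-0-cong (no _) (no _) f g e = refl

sumOver : List A → (A → ℤ) → ℤ
sumOver [] f = + 0
sumOver (x ∷ xs) f = f x +ᶻ sumOver xs f

sumOver-cong : (xs : List A) {f g : A → ℤ} → (∀ x → f x ≡ g x) → sumOver xs f ≡ sumOver xs g
sumOver-cong [] e = refl
sumOver-cong (x ∷ xs) e = cong₂ _+ᶻ_ (e x) (sumOver-cong xs e)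

sumOver-cong-∈ : (xs : List A) {f g : A → ℤ} → (∀ x → x ∈ xs → f x ≡ g x) → sumOver xs f ≡ sumOver xs g
sumOver-cong-∈ [] e = refl
sumOver-cong-∈ (x ∷ xs) e = cong₂ _+ᶻ_ (e x (here refl)) (sumOver-cong-∈ xs (λ y y∈ → e y (there y∈)))

sumOver-++ : (xs ys : List A) (f : A → ℤ) → sumOver (xs ++ ys) f ≡ sumOver xs f +ᶻ sumOver ys f
sumOver-++ [] ys f = sym (ℤP.+-identityˡ _)
sumOver-++ (x ∷ xs) ys f = trans (cong (f x +ᶻ_) (sumOver-++ xs ys f)) (sym (ℤP.+-assoc (f x) _ _))

sumOver-+ : (xs : List A) (f g : A → ℤ) → sumOver xs (λ x → f x +ᶻ g x) ≡ sumOver xs f +ᶻ sumOver xs g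
sumOver-+ [] f g = refl
sumOver-+ (x ∷ xs) f g = trans (cong ((f x +ᶻ g x) +ᶻ_) (sumOver-+ xs f g)) (+-interchange (f x) (g x) _ _)

sumOver-*ˡ : (xs : List A) (c : ℤ) (f : A → ℤ) → sumOver xs (λ x → c *ᶻ f x) ≡ c *ᶻ sumOver xs f
sumOver-*ˡ [] c f = sym (ℤP.*-zeroʳ c)
sumOver-*ˡ (x ∷ xs) c f = trans (cong (c *ᶻ f x +ᶻ_) (sumOver-*ˡ xs c f)) (sym (ℤP.*-distribˡ-+ c (f x) _))

sumOver-zero : (xs : List A) (f : A → ℤ) → (∀ x → f x ≡ + 0) → sumOver xs f ≡ + 0
sumOver-zero [] f e = refl
sumOver-zero (x ∷ xs) f e = trans (cong₂ _+ᶻ_ (e x) (sumOver-zero xs f e)) refl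

sumOver-const : (xs : List A) (c : ℤ) → sumOver xs (λ _ → c) ≡ + length xs *ᶻ c
sumOver-const [] c = sym (ℤP.*-zeroˡ c)
sumOver-const (x ∷ xs) c = trans (cong (c +ᶻ_) (sumOver-const xs c))
  (trans (cong (_+ᶻ (+ length xs *ᶻ c)) (sym (ℤP.*-identityˡ c))) (sym (ℤP.*-distribʳ-+ c (+ 1) (+ length xs))))

sumOver-swap : (xs : List A) (ys : List B) (f : A → B → ℤ) →
  sumOver xs (λ x → sumOver ys (f x)) ≡ sumOver ys (λ y → sumOver xs (λ x → f x y))
sumOver-swap [] ys f = sym (sumOver-zero ys _ (λ _ → refl))
sumOver-swap (x ∷ xs) ys f = trans (cong (sumOver ys (f x) +ᶻ_) (sumOver-swap xs ys f))
  (sym (sumOver-+ ys (f x) (λ y → sumOver xs (λ x′ → f x′ y))))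

sumOver-map : (h : A → B) (xs : List A) (f : B → ℤ) → sumOver (map h xs) f ≡ sumOver xs (f ∘ h)
sumOver-map h [] f = refl
sumOver-map h (x ∷ xs) f = cong (f (h x) +ᶻ_) (sumOver-map h xs f)

sumOver-concatMap : (g : A → List B) (xs : List A) (f : B → ℤ) →
  sumOver (concatMap g xs) f ≡ sumOver xs (λ x → sumOver (g x) f)
sumOver-concatMap g [] f = refl
sumOver-concatMap g (x ∷ xs) f =
  trans (sumOver-++ (g x) (concatMap g xs) f) (cong (sumOver (g x) f +ᶻ_) (sumOver-concatMap g xs f))

∑< : ℕ → (ℕ → ℤ) → ℤ
∑< zero f = + 0
∑< (suc k) f = f 0 +ᶻ ∑< k (f ∘ suc)

∑<-cong : ∀ k {f g : ℕ → ℤ} → (∀ i → i < k → f i ≡ g i) → ∑< k f ≡ ∑< k g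
∑<-cong zero e = refl
∑<-cong (suc k) e = cong₂ _+ᶻ_ (e 0 (s≤s z≤n)) (∑<-cong k (λ i i<k → e (suc i) (s≤s i<k)))

∑<-zero : ∀ k (f : ℕ → ℤ) → (∀ i → i < k → f i ≡ + 0) → ∑< k f ≡ + 0
∑<-zero zero f e = refl
∑<-zero (suc k) f e = cong₂ _+ᶻ_ (e 0 (s≤s z≤n)) (∑<-zero k (f ∘ suc) (λ i i<k → e (suc i) (s≤s i<k)))

∑<-const-1 : ∀ k → ∑< k (λ _ → + 1) ≡ + k
∑<-const-1 zero = refl
∑<-const-1 (suc k) = cong (+ 1 +ᶻ_) (∑<-const-1 k)

∑<-+ : ∀ k (f g : ℕ → ℤ) → ∑< k (λ i → f i +ᶻ g i) ≡ ∑< k f +ᶻ ∑< k g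
∑<-+ zero f g = refl
∑<-+ (suc k) f g = trans (cong ((f 0 +ᶻ g 0) +ᶻ_) (∑<-+ k (f ∘ suc) (g ∘ suc))) (+-interchange (f 0) (g 0) _ _)

∑<-*ˡ : ∀ k (c : ℤ) (f : ℕ → ℤ) → ∑< k (λ i → c *ᶻ f i) ≡ c *ᶻ ∑< k f
∑<-*ˡ zero c f = sym (ℤP.*-zeroʳ c)
∑<-*ˡ (suc k) c f = trans (cong (c *ᶻ f 0 +ᶻ_) (∑<-*ˡ k c (f ∘ suc))) (sym (ℤP.*-distribˡ-+ c (f 0) _))

∑<-neg : ∀ k (f : ℕ → ℤ) → ∑< k (λ i → - f i) ≡ - ∑< k f
∑<-neg zero f = refl
∑<-neg (suc k) f = trans (cong (- f 0 +ᶻ_) (∑<-neg k (f ∘ suc))) (sym (ℤP.neg-distrib-+ (f 0) _))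

∑<-split : ∀ a b (f : ℕ → ℤ) → ∑< (a + b) f ≡ ∑< a f +ᶻ ∑< b (λ i → f (a + i))
∑<-split zero b f = sym (ℤP.+-identityˡ _)
∑<-split (suc a) b f = trans (cong (f 0 +ᶻ_) (∑<-split a b (f ∘ suc))) (sym (ℤP.+-assoc (f 0) _ _))

∑<-snoc : ∀ k (f : ℕ → ℤ) → ∑< (suc k) f ≡ ∑< k f +ᶻ f k
∑<-snoc zero f = trans (ℤP.+-identityʳ (f 0)) (sym (ℤP.+-identityˡ (f 0)))
∑<-snoc (suc k) f = trans (cong (f 0 +ᶻ_) (∑<-snoc k (f ∘ suc))) (sym (ℤP.+-assoc (f 0) _ _))

∑<-truncate : ∀ {a b} (f : ℕ → ℤ) → a ≤ b → (∀ i → a ≤ i → f i ≡ + 0) → ∑< b f ≡ ∑< a f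
∑<-truncate {a} {b} f a≤b e = begin
  ∑< b f                                      ≡⟨ cong (λ k → ∑< k f) (sym (ℕP.m+[n∸m]≡n a≤b)) ⟩
  ∑< (a + (b ∸ a)) f                          ≡⟨ ∑<-split a (b ∸ a) f ⟩
  ∑< a f +ᶻ ∑< (b ∸ a) (λ i → f (a + i))      ≡⟨ cong (∑< a f +ᶻ_) (∑<-zero (b ∸ a) _ (λ i _ → e (a + i) (ℕP.m≤m+n a i))) ⟩
  ∑< a f +ᶻ + 0                               ≡⟨ ℤP.+-identityʳ _ ⟩
  ∑< a f                                      ∎
  where open ≡-Reasoning

∑<-swap : ∀ a b (f : ℕ → ℕ → ℤ) → ∑< a (λ i → ∑< b (f i)) ≡ ∑< b (λ j → ∑< a (λ i → f i j))
∑<-swap zero b f = sym (∑<-zero b _ (λ _ _ → refl))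
∑<-swap (suc a) b f = trans (cong (∑< b (f 0) +ᶻ_) (∑<-swap a b (f ∘ suc)))
  (sym (∑<-+ b (f 0) (λ j → ∑< a (λ i → f (suc i) j))))

∑<-sumOver : ∀ k (ys : List B) (f : ℕ → B → ℤ) →
  ∑< k (λ i → sumOver ys (f i)) ≡ sumOver ys (λ y → ∑< k (λ i → f i y))
∑<-sumOver zero ys f = sym (sumOver-zero ys _ (λ _ → refl))
∑<-sumOver (suc k) ys f = trans (cong (sumOver ys (f 0) +ᶻ_) (∑<-sumOver k ys (f ∘ suc)))
  (sym (sumOver-+ ys (f 0) (λ y → ∑< k (λ i → f (suc i) y))))

∑<-delta : ∀ k t (f : ℕ → ℤ) → t < k → ∑< k (λ i → 𝟙 (t ℕP.≟ i) *ᶻ f i) ≡ f t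
∑<-delta (suc k) zero f _ =
  trans (cong₂ _+ᶻ_ (ℤP.*-identityˡ (f 0)) (∑<-zero k _ (λ _ _ → refl))) (ℤP.+-identityʳ (f 0))
∑<-delta (suc k) (suc t) f (s≤s t<k) = trans (ℤP.+-identityˡ _)
  (trans (∑<-cong k (λ i _ → cong (_*ᶻ f (suc i)) (𝟙-cong (suc t ℕP.≟ suc i) (t ℕP.≟ i) ℕP.suc-injective (cong suc))))
         (∑<-delta k t (f ∘ suc) t<k))

foldr-applyUpTo : ∀ k (f : ℕ → ℤ) → foldr _+ᶻ_ (+ 0) (applyUpTo f k) ≡ ∑< k f
foldr-applyUpTo zero f = refl
foldr-applyUpTo (suc k) f = cong (f 0 +ᶻ_) (foldr-applyUpTo k (f ∘ suc))

sumOver-tabulate : ∀ k (g : Fin k → A) (F : A → ℤ) (f : ℕ → ℤ) →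
  (∀ i → F (g i) ≡ f (toℕ i)) → sumOver (tabulate g) F ≡ ∑< k f
sumOver-tabulate zero g F f e = refl
sumOver-tabulate (suc k) g F f e = cong₂ _+ᶻ_ (e fzero) (sumOver-tabulate k (g ∘ fsuc) F (f ∘ suc) (e ∘ fsuc))

sumOver-allFin : ∀ k (f : ℕ → ℤ) → sumOver (allFin k) (f ∘ toℕ) ≡ ∑< k f
sumOver-allFin k f = sumOver-tabulate k (λ i → i) (f ∘ toℕ) f (λ _ → refl)

any<? : (P : ℕ → Set) → Decidable P → ∀ N → Dec (Σ ℕ λ k → k < N × P k)
any<? P P? zero = no (λ { (k , () , _) })
any<? P P? (suc N) with any<? P P? N | P? N
... | yes (k , k<N , pk) | _ = yes (k , ℕP.m≤n⇒m≤1+n k<N , pk)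
... | no _ | yes pN = yes (N , ℕP.≤-refl , pN)
... | no none | no ¬pN = no λ { (k , k<1+N , pk) → [ (λ k<N → none (k , k<N , pk)) , (λ { refl → ¬pN pk }) ]′ (ℕP.m<1+n⇒m<n∨m≡n k<1+N) }

least : {P : ℕ → Set} → Decidable P → ∀ {n} → P n → Σ ℕ λ p → P p × (∀ k → k < p → ¬ P k)
least {P} P? {n} pn = search 0 (λ _ ()) n refl
  where
  search : ∀ i → (∀ k → k < i → ¬ P k) → ∀ fuel → i + fuel ≡ n → Σ ℕ λ p → P p × (∀ k → k < p → ¬ P k)
  search i none fuel e with P? i
  ... | yes pi = i , pi , none
  search i none zero e | no ¬pi = ⊥-elim (¬pi (subst P (trans (sym e) (ℕP.+-identityʳ i)) pn))
  search i none (suc fuel) e | no ¬pi = search (suc i) none′ fuel (trans (sym (ℕP.+-suc i fuel)) e)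
    where
    none′ : ∀ k → k < suc i → ¬ P k
    none′ k k<1+i = [ none k , (λ { refl → ¬pi }) ]′ (ℕP.m<1+n⇒m<n∨m≡n k<1+i)

-- Cyclic rotation of words

prefix-unique : (t u v w : List A) → length t ≡ length u → t ++ v ≡ u ++ w → t ≡ u
prefix-unique [] [] v w _ _ = refl
prefix-unique (x ∷ t) (y ∷ u) v w len e =
  cong₂ _∷_ (LP.∷-injectiveˡ e) (prefix-unique t u v w (ℕP.suc-injective len) (LP.∷-injectiveʳ e))

rotate : List A → List A
rotate [] = []
rotate (x ∷ xs) = xs ++ [ x ]

rotate^ : ℕ → List A → List A
rotate^ zero v = v
rotate^ (suc k) v = rotate^ k (rotate v)

power : List A → ℕ → List A
power u m = concat (replicate m u)

length-rotate : (v : List A) → length (rotate v) ≡ length v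
length-rotate [] = refl
length-rotate (x ∷ xs) = trans (LP.length-++ xs) (ℕP.+-comm (length xs) 1)

length-rotate^ : ∀ k (v : List A) → length (rotate^ k v) ≡ length v
length-rotate^ zero v = refl
length-rotate^ (suc k) v = trans (length-rotate^ k (rotate v)) (length-rotate v)

length-power : (u : List A) (m : ℕ) → length (power u m) ≡ m * length u
length-power u zero = refl
length-power u (suc m) = trans (LP.length-++ u) (cong (λ k → length u + k) (length-power u m))

rotate^-+ : ∀ a b (v : List A) → rotate^ (a + b) v ≡ rotate^ b (rotate^ a v)
rotate^-+ zero b v = refl
rotate^-+ (suc a) b v = rotate^-+ a b (rotate v)

rotate^-comm : ∀ a b (v : List A) → rotate^ a (rotate^ b v) ≡ rotate^ b (rotate^ a v)
rotate^-comm a b v = trans (sym (rotate^-+ b a v)) (trans (cong (λ k → rotate^ k v) (ℕP.+-comm b a)) (rotate^-+ a b v))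

rotate^-suc : ∀ k (v : List A) → rotate^ (suc k) v ≡ rotate (rotate^ k v)
rotate^-suc k v = trans (cong (λ j → rotate^ j v) (ℕP.+-comm 1 k)) (rotate^-+ k 1 v)

rotate^-[] : ∀ k → rotate^ {A} k [] ≡ []
rotate^-[] zero = refl
rotate^-[] (suc k) = rotate^-[] k

rotate^-++ : (u w : List A) → rotate^ (length u) (u ++ w) ≡ w ++ u
rotate^-++ [] w = sym (LP.++-identityʳ w)
rotate^-++ (x ∷ u) w = trans (cong (rotate^ (length u)) (LP.++-assoc u w [ x ]))
  (trans (rotate^-++ u (w ++ [ x ])) (LP.++-assoc w [ x ] u))

power-comm : (u : List A) (m : ℕ) → power u m ++ u ≡ u ++ power u m
power-comm u zero = sym (LP.++-identityʳ u)
power-comm u (suc m) = trans (LP.++-assoc u (power u m) u) (cong (u ++_) (power-comm u m))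

IsPeriod : ℕ → List A → Set
IsPeriod g v = rotate^ g v ≡ v

isPeriod? : DecidableEquality A → ∀ g (v : List A) → Dec (IsPeriod g v)
isPeriod? _≟_ g v = LP.≡-dec _≟_ (rotate^ g v) v

isPeriod-length : (v : List A) → IsPeriod (length v) v
isPeriod-length v = trans (cong (rotate^ (length v)) (sym (LP.++-identityʳ v))) (rotate^-++ v [])

isPeriod-power : (u : List A) (m : ℕ) → IsPeriod (length u) (power u m)
isPeriod-power u zero = rotate^-[] (length u)
isPeriod-power u (suc m) = trans (rotate^-++ u (power u m)) (power-comm u m)

module _ {v : List A} where

  isPeriod-+ : ∀ {a b} → IsPeriod a v → IsPeriod b v → IsPeriod (a + b) v
  isPeriod-+ {a} {b} pa pb = trans (rotate^-+ a b v) (trans (cong (rotate^ b) pa) pb)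

  isPeriod-∸ : ∀ {a b} → IsPeriod a v → IsPeriod (a + b) v → IsPeriod b v
  isPeriod-∸ {a} {b} pa pab = trans (cong (rotate^ b) (sym pa)) (trans (sym (rotate^-+ a b v)) pab)

  isPeriod-* : ∀ {a} k → IsPeriod a v → IsPeriod (k * a) v
  isPeriod-* zero pa = refl
  isPeriod-* {a} (suc k) pa = isPeriod-+ {a} {k * a} pa (isPeriod-* k pa)

  isPeriod-∣ : ∀ {p g} → IsPeriod p v → p ∣ g → IsPeriod g v
  isPeriod-∣ pp (divides q refl) = isPeriod-* q pp

  isPeriod-% : ∀ {p g} .{{_ : NonZero p}} → IsPeriod p v → IsPeriod g v → IsPeriod (g % p) v
  isPeriod-% {p} {g} pp pg = isPeriod-∸ {(g / p) * p} {g % p} (isPeriod-* (g / p) pp)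
    (subst (λ k → IsPeriod k v) (trans (ℕDM.m≡m%n+[m/n]*n g p) (ℕP.+-comm (g % p) _)) pg)

isPeriod-rotate^ : ∀ g j {v : List A} → IsPeriod g v → IsPeriod g (rotate^ j v)
isPeriod-rotate^ g j {v} pg = trans (rotate^-comm g j v) (cong (rotate^ j) pg)

commuting⇒power : ∀ q (u w : List A) → length w ≡ q * length u → w ++ u ≡ u ++ w → w ≡ power u q
commuting⇒power zero u [] _ _ = refl
commuting⇒power (suc q) u w lw comm = begin
  w                   ≡⟨ sym (LP.take++drop≡id (length u) w) ⟩
  t ++ w′             ≡⟨ cong₂ _++_ t≡u (commuting⇒power q u w′ lw′ comm′) ⟩
  u ++ power u q      ∎
  where
  open ≡-Reasoning
  t = take (length u) w
  w′ = drop (length u) w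
  lt : length t ≡ length u
  lt = trans (LP.length-take (length u) w) (ℕP.m≤n⇒m⊓n≡m (subst (length u ≤_) (sym lw) (ℕP.m≤m+n _ _)))
  lw′ : length w′ ≡ q * length u
  lw′ = trans (LP.length-drop (length u) w) (trans (cong (_∸ length u) lw) (ℕP.m+n∸m≡n (length u) _))
  w≡t++w′ : t ++ w′ ≡ w
  w≡t++w′ = LP.take++drop≡id (length u) w
  t≡u : t ≡ u
  t≡u = prefix-unique t u (w′ ++ u) w lt
    (trans (sym (LP.++-assoc t w′ u)) (trans (cong (_++ u) w≡t++w′) comm))
  comm′ : w′ ++ u ≡ u ++ w′
  comm′ = LP.++-cancelˡ u (w′ ++ u) (u ++ w′) (begin
    u ++ w′ ++ u        ≡⟨ sym (LP.++-assoc u w′ u) ⟩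
    (u ++ w′) ++ u      ≡⟨ cong (λ z → (z ++ w′) ++ u) (sym t≡u) ⟩
    (t ++ w′) ++ u      ≡⟨ cong (_++ u) w≡t++w′ ⟩
    w ++ u              ≡⟨ comm ⟩
    u ++ w              ≡⟨ cong (λ z → u ++ z) (sym w≡t++w′) ⟩
    u ++ t ++ w′        ≡⟨ cong (λ z → u ++ z ++ w′) t≡u ⟩
    u ++ u ++ w′        ∎)

isPeriod-++⇒power : ∀ q (u w : List A) → length w ≡ q * length u → IsPeriod (length u) (u ++ w) → w ≡ power u q
isPeriod-++⇒power q u w lw p = commuting⇒power q u w lw (trans (sym (rotate^-++ u w)) p)

isPeriod⇒power : ∀ q g (v : List A) → length v ≡ suc q * g → IsPeriod g v → v ≡ power (take g v) (suc q)
isPeriod⇒power q g v lv pg =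
  trans (sym (LP.take++drop≡id g v)) (cong (u ++_) (isPeriod-++⇒power q u w lw pu))
  where
  u = take g v
  w = drop g v
  lu : length u ≡ g
  lu = trans (LP.length-take g v) (ℕP.m≤n⇒m⊓n≡m (subst (g ≤_) (sym lv) (ℕP.m≤m+n g (q * g))))
  lw : length w ≡ q * length u
  lw = trans (LP.length-drop g v) (trans (cong (_∸ g) lv) (trans (ℕP.m+n∸m≡n g (q * g)) (cong (q *_) (sym lu))))
  pu : IsPeriod (length u) (u ++ w)
  pu = subst (λ k → IsPeriod k (u ++ w)) (sym lu)
         (subst (IsPeriod g) (sym (LP.take++drop≡id g v)) pg)

record MinimalPeriod (v : List A) : Set where
  field
    period : ℕ
    period>0 : 0 < period
    isPeriod : IsPeriod period v
    divides-periods : ∀ g → IsPeriod g v → period ∣ g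

  divides-length : period ∣ length v
  divides-length = divides-periods (length v) (isPeriod-length v)

minimalPeriod : DecidableEquality A → (v : List A) → 0 < length v → MinimalPeriod v
minimalPeriod _≟_ v lv = record
  { period = p ; period>0 = proj₁ pp ; isPeriod = proj₂ pp ; divides-periods = divides-periods }
  where
  PositivePeriod : ℕ → Set
  PositivePeriod g = 0 < g × IsPeriod g v
  positivePeriod? : Decidable PositivePeriod
  positivePeriod? g = (0 ℕP.<? g) ×-dec isPeriod? _≟_ g v
  smallest = least positivePeriod? (lv , isPeriod-length v)
  p = proj₁ smallest
  pp = proj₁ (proj₂ smallest)
  instance
    p≢0 : NonZero p
    p≢0 = ℕ.>-nonZero (proj₁ pp)
  divides-periods : ∀ g → IsPeriod g v → p ∣ g
  divides-periods g pg with g % p in eq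
  ... | zero = ℕD.m%n≡0⇒n∣m g p eq
  ... | suc r = ⊥-elim (proj₂ (proj₂ smallest) (suc r) (subst (_< p) eq (ℕDM.m%n<n g p))
                  (s≤s z≤n , subst (λ k → IsPeriod k v) eq (isPeriod-% {p = p} {g = g} (proj₂ pp) pg)))

-- The Möbius function

NoFactorBelow : ℕ → ℕ → Set
NoFactorBelow b k = ∀ t → 2 ≤ t → t < b → ¬ t ∣ k

module _ {k q : ℕ} where

  noFactorBelow⇒≤ : NoFactorBelow (2 + q) k → 2 ≤ k → 2 + q ≤ k
  noFactorBelow⇒≤ nf 2≤k with 2 + q ℕP.≤? k
  ... | yes le = le
  ... | no nle = ⊥-elim (nf k 2≤k (ℕP.≰⇒> nle) ℕD.∣-refl)

  noFactorBelow-suc : NoFactorBelow (2 + q) k → ¬ (2 + q) ∣ k → NoFactorBelow (3 + q) k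
  noFactorBelow-suc nf nd t 2≤t t<3+q with ℕP.m<1+n⇒m<n∨m≡n t<3+q
  ... | inj₁ t<2+q = nf t 2≤t t<2+q
  ... | inj₂ refl = nd

  noFactorBelow-/ : NoFactorBelow (2 + q) k → (2 + q) ∣ k → ¬ (2 + q) * (2 + q) ∣ k →
    NoFactorBelow (3 + q) (k / (2 + q))
  noFactorBelow-/ nf p∣k ¬p²∣k t 2≤t t<3+q t∣k/p with ℕP.m<1+n⇒m<n∨m≡n t<3+q
  ... | inj₁ t<2+q = nf t 2≤t t<2+q (ℕD.∣-trans t∣k/p (ℕD.m/n∣m p∣k))
  ... | inj₂ refl = ¬p²∣k (ℕD.m∣n/o⇒m*o∣n p∣k t∣k/p)

mobius-go-≤1 : ∀ f k q → k ≤ 1 → mobius-go f k q ≡ + 1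
mobius-go-≤1 zero k q _ = refl
mobius-go-≤1 (suc f) zero q _ = refl
mobius-go-≤1 (suc f) (suc zero) q _ = refl
mobius-go-≤1 (suc f) (suc (suc k)) q (s≤s ())

mobius-go-skip : ∀ f q {k} → 2 ≤ k → ¬ (2 + q) ∣ k → mobius-go (suc f) k q ≡ mobius-go f k (suc q)
mobius-go-skip f q {suc (suc k)} _ p∤k = if-no ((2 + q) ∣? suc (suc k)) p∤k
mobius-go-skip f q {suc zero} (s≤s ()) _

mobius-go-square : ∀ f q {k} → 2 ≤ k → (2 + q) ∣ k → (2 + q) * (2 + q) ∣ k → mobius-go (suc f) k q ≡ + 0
mobius-go-square f q {suc (suc k)} _ p∣k p²∣k =
  trans (if-yes ((2 + q) ∣? suc (suc k)) p∣k) (if-yes ((2 + q) * (2 + q) ∣? suc (suc k)) p²∣k)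
mobius-go-square f q {suc zero} (s≤s ()) _ _

mobius-go-divide : ∀ f q {k} → 2 ≤ k → (2 + q) ∣ k → ¬ (2 + q) * (2 + q) ∣ k →
  mobius-go (suc f) k q ≡ - mobius-go f (k / (2 + q)) (suc q)
mobius-go-divide f q {suc (suc k)} _ p∣k ¬p²∣k =
  trans (if-yes ((2 + q) ∣? suc (suc k)) p∣k) (if-no ((2 + q) * (2 + q) ∣? suc (suc k)) ¬p²∣k)
mobius-go-divide f q {suc zero} (s≤s ()) _ _

-- Enough fuel for the trial division of k from 2 + q on.
Fuel : ℕ → ℕ → ℕ → Set
Fuel f k q = k ≤ f + q + 1

≤1-if-no-fuel : ∀ {k q} → NoFactorBelow (2 + q) k → Fuel 0 k q → k ≤ 1
≤1-if-no-fuel {k} {q} nf fuel with 2 ℕP.≤? k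
... | no ¬2≤k = ℕP.≤-pred (ℕP.≰⇒> ¬2≤k)
... | yes 2≤k = ⊥-elim (ℕP.<-irrefl refl
        (ℕP.≤-trans (ℕP.≤-trans (noFactorBelow⇒≤ nf 2≤k) fuel) (ℕP.≤-reflexive (ℕP.+-comm q 1))))

mobius-go-fuel : ∀ f g k q → NoFactorBelow (2 + q) k → Fuel f k q → Fuel g k q →
  mobius-go f k q ≡ mobius-go g k q
mobius-go-fuel zero g k q nf ff fg =
  trans (mobius-go-≤1 0 k q k≤1) (sym (mobius-go-≤1 g k q k≤1))
  where k≤1 = ≤1-if-no-fuel nf ff
mobius-go-fuel (suc f) zero k q nf ff fg =
  trans (mobius-go-≤1 (suc f) k q k≤1) (sym (mobius-go-≤1 0 k q k≤1))
  where k≤1 = ≤1-if-no-fuel nf fg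
mobius-go-fuel (suc f) (suc g) k q nf ff fg with 2 ℕP.≤? k
... | no ¬2≤k = trans (mobius-go-≤1 (suc f) k q k≤1) (sym (mobius-go-≤1 (suc g) k q k≤1))
  where k≤1 = ℕP.≤-pred (ℕP.≰⇒> ¬2≤k)
... | yes 2≤k with (2 + q) ∣? k
...   | no p∤k = trans (mobius-go-skip f q 2≤k p∤k)
          (trans (mobius-go-fuel f g k (suc q) (noFactorBelow-suc nf p∤k) (shift f ff) (shift g fg))
                 (sym (mobius-go-skip g q 2≤k p∤k)))
  where
  shift : ∀ h → Fuel (suc h) k q → Fuel h k (suc q)
  shift h = subst (k ≤_) (cong (_+ 1) (sym (ℕP.+-suc h q)))
...   | yes p∣k with (2 + q) * (2 + q) ∣? k
...     | yes p²∣k = trans (mobius-go-square f q 2≤k p∣k p²∣k) (sym (mobius-go-square g q 2≤k p∣k p²∣k))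
...     | no ¬p²∣k = trans (mobius-go-divide f q 2≤k p∣k ¬p²∣k)
          (trans (cong -_ (mobius-go-fuel f g (k / (2 + q)) (suc q) (noFactorBelow-/ nf p∣k ¬p²∣k)
                             (shift f ff) (shift g fg)))
                 (sym (mobius-go-divide g q 2≤k p∣k ¬p²∣k)))
  where
  shift : ∀ h → Fuel (suc h) k q → Fuel h (k / (2 + q)) (suc q)
  shift h fuel = ℕP.≤-trans (ℕDM.m/n≤m k (2 + q)) (subst (k ≤_) (cong (_+ 1) (sym (ℕP.+-suc h q))) fuel)

mobius-go-skipAll : ∀ j f k q → NoFactorBelow (2 + q + j) k → mobius-go (j + f) k q ≡ mobius-go f k (q + j)
mobius-go-skipAll zero f k q nf = cong (mobius-go f k) (sym (ℕP.+-identityʳ q))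
mobius-go-skipAll (suc j) f k q nf with 2 ℕP.≤? k
... | no ¬2≤k = trans (mobius-go-≤1 (suc j + f) k q k≤1) (sym (mobius-go-≤1 f k (q + suc j) k≤1))
  where k≤1 = ℕP.≤-pred (ℕP.≰⇒> ¬2≤k)
... | yes 2≤k = trans (mobius-go-skip (j + f) q 2≤k p∤k)
    (trans (mobius-go-skipAll j f k (suc q) (subst (λ b → NoFactorBelow (2 + b) k) (ℕP.+-suc q j) nf))
           (cong (mobius-go f k) (sym (ℕP.+-suc q j))))
  where
  p∤k : ¬ (2 + q) ∣ k
  p∤k = nf (2 + q) (s≤s (s≤s z≤n)) (ℕP.+-monoʳ-< 2 (ℕP.m<m+n q (s≤s z≤n)))

fuel-≤ : ∀ {f k} q → k ≤ f → Fuel f k q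
fuel-≤ {f} q k≤f = ℕP.≤-trans k≤f (ℕP.≤-trans (ℕP.m≤m+n f q) (ℕP.m≤m+n (f + q) 1))

-- μ k runs the same trial division from 2, and the divisors 2, …, q + 1 skipped before 2 + q do not divide k.
mobius-go≡μ : ∀ f k q → NoFactorBelow (2 + q) k → Fuel f k q → mobius-go f k q ≡ μ k
mobius-go≡μ f k q nf fuel with 2 ℕP.≤? k
... | no ¬2≤k = trans (mobius-go-≤1 f k q k≤1) (sym (mobius-go-≤1 (2 * k + 2) k 0 k≤1))
  where k≤1 = ℕP.≤-pred (ℕP.≰⇒> ¬2≤k)
... | yes 2≤k = trans (mobius-go-fuel f F k q nf fuel (ℕP.m≤n⇒m≤n+o 1 k≤F+q))
                      (trans (sym (mobius-go-skipAll q F k 0 nf)) (cong (λ g → mobius-go g k 0) q+F≡2k+2))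
  where
  F = 2 * k + 2 ∸ q
  q≤2k+2 : q ≤ 2 * k + 2
  q≤2k+2 = ℕP.≤-trans (ℕP.m≤n+m q 2) (ℕP.≤-trans (noFactorBelow⇒≤ nf 2≤k)
             (ℕP.≤-trans (ℕP.m≤m+n k (k + 0)) (ℕP.m≤m+n (2 * k) 2)))
  q+F≡2k+2 : q + F ≡ 2 * k + 2
  q+F≡2k+2 = ℕP.m+[n∸m]≡n q≤2k+2
  k≤F+q : k ≤ F + q
  k≤F+q = ℕP.≤-trans (ℕP.≤-trans (ℕP.m≤m+n k (k + 0)) (ℕP.m≤m+n (2 * k) 2))
             (ℕP.≤-reflexive (trans (sym q+F≡2k+2) (ℕP.+-comm q F)))

module _ {ω q : ℕ} (nf : NoFactorBelow (2 + q) ω) (p∣ω : (2 + q) ∣ ω) (0<ω : 0 < ω) where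

  private
    2≤ω : 2 ≤ ω
    2≤ω = ℕP.≤-trans (s≤s (s≤s z≤n)) (ℕD.∣⇒≤ {{ℕ.>-nonZero 0<ω}} p∣ω)

    μ-fuelled : μ ω ≡ mobius-go (suc ω) ω q
    μ-fuelled = sym (mobius-go≡μ (suc ω) ω q nf (fuel-≤ q (ℕP.n≤1+n ω)))

  μ-square : (2 + q) * (2 + q) ∣ ω → μ ω ≡ + 0
  μ-square p²∣ω = trans μ-fuelled (mobius-go-square ω q 2≤ω p∣ω p²∣ω)

  μ-divide : ¬ (2 + q) * (2 + q) ∣ ω → μ ω ≡ - μ (ω / (2 + q))
  μ-divide ¬p²∣ω = trans μ-fuelled (trans (mobius-go-divide ω q 2≤ω p∣ω ¬p²∣ω)
    (cong -_ (mobius-go≡μ ω (ω / (2 + q)) (suc q) (noFactorBelow-/ nf p∣ω ¬p²∣ω)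
                (fuel-≤ (suc q) (ℕDM.m/n≤m ω (2 + q))))))

leastFactor : ∀ K → 2 ≤ K → Σ ℕ λ q → (2 + q) ∣ K × NoFactorBelow (2 + q) K
leastFactor K 2≤K with least factor? (2≤K , ℕD.∣-refl)
  where
  factor? : Decidable (λ t → 2 ≤ t × t ∣ K)
  factor? t = (2 ℕP.≤? t) ×-dec (t ∣? K)
... | suc (suc q) , (_ , p∣K) , smaller = q , p∣K , λ t 2≤t t<p t∣K → smaller t t<p (2≤t , t∣K)
... | suc zero , (s≤s () , _) , _

positive-factor : ∀ {a b c} → c ≡ a * b → 0 < c → 0 < a
positive-factor {suc a} _ _ = s≤s z≤n
positive-factor {zero} refl ()

divisorSum : ℕ → (ℕ → ℤ) → ℤ
divisorSum K h = ∑< K (λ i → 𝟙 (suc i ∣? K) *ᶻ h (suc i))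

∑<-multiples : ∀ m (h : ℕ → ℤ) k →
  ∑< (k * suc m) (λ i → 𝟙 (suc m ∣? suc i) *ᶻ h (suc i)) ≡ ∑< k (λ e → h (suc e * suc m))
∑<-multiples m h zero = refl
∑<-multiples m h (suc k) = trans (∑<-split (suc m) (k * suc m) f) (cong₂ _+ᶻ_ firstBlock laterBlocks)
  where
  f : ℕ → ℤ
  f i = 𝟙 (suc m ∣? suc i) *ᶻ h (suc i)
  firstBlock : ∑< (suc m) f ≡ h (1 * suc m)
  firstBlock = trans (∑<-snoc m f) (trans (cong₂ _+ᶻ_ (∑<-zero m f below)
      (trans (cong (_*ᶻ h (suc m)) (𝟙-yes (suc m ∣? suc m) ℕD.∣-refl)) (ℤP.*-identityˡ _)))
      (trans (ℤP.+-identityˡ _) (cong h (sym (ℕP.*-identityˡ (suc m))))))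
    where
    below : ∀ i → i < m → f i ≡ + 0
    below i i<m = cong (_*ᶻ h (suc i))
      (𝟙-no (suc m ∣? suc i) (ℕD.>⇒∤ (s≤s i<m)))
  laterBlocks : ∑< (k * suc m) (λ i → f (suc m + i)) ≡ ∑< k (λ e → h (suc (suc e) * suc m))
  laterBlocks = trans (∑<-cong (k * suc m) (λ i _ → cong₂ _*ᶻ_
      (𝟙-cong (suc m ∣? suc (suc m + i)) (suc m ∣? suc i)
        (λ m∣ → ℕD.∣m+n∣m⇒∣n (subst (suc m ∣_) (sym (ℕP.+-suc (suc m) i)) m∣) ℕD.∣-refl)
        (λ m∣ → subst (suc m ∣_) (ℕP.+-suc (suc m) i) (ℕD.∣m∣n⇒∣m+n ℕD.∣-refl m∣)))
      (cong h (sym (ℕP.+-suc (suc m) i)))))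
    (∑<-multiples m (λ x → h (suc m + x)) k)

-- Splitting the divisors ω of K = K′ p by whether the least prime factor p divides ω:
-- those with p ∤ ω are the divisors of K′ prime to p, and ω = e p contributes μ(e p) = -[p ∤ e] μ(e).
module _ (K q K′ : ℕ) (K≡K′p : K ≡ K′ * (2 + q)) (nf : NoFactorBelow (2 + q) K) (0<K : 0 < K) where

  private
    p = 2 + q

    coprimeDivisor : ∀ {ω} → ω ∣ K → ¬ p ∣ ω → ω ∣ K′
    coprimeDivisor {ω} ω∣K p∤ω = coprime-divisor coprime (subst (ω ∣_) (trans K≡K′p (ℕP.*-comm K′ p)) ω∣K)
      where
      coprime : Coprime ω p
      coprime {zero} (_ , 0∣p) with () ← ℕD.0∣⇒≡0 0∣p
      coprime {suc zero} _ = refl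
      coprime {suc (suc c)} (c∣ω , c∣p) with ℕP.m≤n⇒m<n∨m≡n (ℕD.∣⇒≤ c∣p)
      ... | inj₁ c<p = ⊥-elim (nf (suc (suc c)) (s≤s (s≤s z≤n)) c<p (ℕD.∣-trans c∣ω ω∣K))
      ... | inj₂ refl = ⊥-elim (p∤ω c∣ω)

    K′∣K : K′ ∣ K
    K′∣K = divides p (trans K≡K′p (ℕP.*-comm K′ p))

    divisorTerm primeToP : ℕ → ℤ
    divisorTerm ω = 𝟙 (ω ∣? K) *ᶻ μ ω
    primeToP ω = 𝟙 (ω ∣? K′) *ᶻ (𝟙 (¬? (p ∣? ω)) *ᶻ μ ω)

    split : ∀ ω → divisorTerm ω ≡ primeToP ω +ᶻ 𝟙 (p ∣? ω) *ᶻ divisorTerm ω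
    split ω with p ∣? ω
    ... | yes _ = sym (trans (cong₂ _+ᶻ_ (ℤP.*-zeroʳ (𝟙 (ω ∣? K′))) (ℤP.*-identityˡ _)) (ℤP.+-identityˡ _))
    ... | no p∤ω = sym (trans (ℤP.+-identityʳ _) (trans (cong (𝟙 (ω ∣? K′) *ᶻ_) (ℤP.*-identityˡ (μ ω)))
        (cong (_*ᶻ μ ω) (𝟙-cong (ω ∣? K′) (ω ∣? K) (λ ω∣K′ → ℕD.∣-trans ω∣K′ K′∣K) (λ ω∣K → coprimeDivisor ω∣K p∤ω)))))

    multiple : ∀ e → 0 < e → divisorTerm (e * p) ≡ - primeToP e
    multiple e 0<e with e ∣? K′
    ... | no e∤K′ = cong (_*ᶻ μ (e * p))
      (𝟙-no (e * p ∣? K) (λ ep∣K → e∤K′ (ℕD.*-cancelʳ-∣ p (subst (e * p ∣_) K≡K′p ep∣K))))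
    ... | yes e∣K′ = trans (cong (_*ᶻ μ (e * p)) (𝟙-yes (e * p ∣? K) ep∣K)) (trans (ℤP.*-identityˡ _) μ-ep)
      where
      ep∣K : e * p ∣ K
      ep∣K = subst (e * p ∣_) (sym K≡K′p) (ℕD.*-monoˡ-∣ p e∣K′)
      nf-ep : NoFactorBelow p (e * p)
      nf-ep t 2≤t t<p t∣ep = nf t 2≤t t<p (ℕD.∣-trans t∣ep ep∣K)
      0<ep : 0 < e * p
      0<ep = ℕP.*-mono-≤ 0<e (s≤s z≤n)
      μ-ep : μ (e * p) ≡ - (+ 1 *ᶻ (𝟙 (¬? (p ∣? e)) *ᶻ μ e))
      μ-ep with p ∣? e
      ... | yes p∣e = μ-square nf-ep (ℕD.n∣m*n e) 0<ep (ℕD.*-monoˡ-∣ p p∣e)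
      ... | no p∤e = trans (μ-divide nf-ep (ℕD.n∣m*n e) 0<ep (λ p²∣ep → p∤e (ℕD.*-cancelʳ-∣ p p²∣ep)))
        (cong -_ (trans (cong μ (ℕDM.m*n/n≡m e p)) (sym (trans (ℤP.*-identityˡ _) (ℤP.*-identityˡ _)))))

  μ-divisorSum-composite : divisorSum K μ ≡ + 0
  μ-divisorSum-composite = begin
    divisorSum K μ
      ≡⟨ ∑<-cong K (λ i _ → split (suc i)) ⟩
    ∑< K (λ i → primeToP (suc i) +ᶻ 𝟙 (p ∣? suc i) *ᶻ divisorTerm (suc i))
      ≡⟨ ∑<-+ K (primeToP ∘ suc) _ ⟩
    ∑< K (primeToP ∘ suc) +ᶻ ∑< K (λ i → 𝟙 (p ∣? suc i) *ᶻ divisorTerm (suc i))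
      ≡⟨ cong₂ _+ᶻ_ primeToP-truncate multiples ⟩
    ∑< K′ (primeToP ∘ suc) +ᶻ - ∑< K′ (primeToP ∘ suc)
      ≡⟨ ℤP.+-inverseʳ (∑< K′ (primeToP ∘ suc)) ⟩
    + 0 ∎
    where
    open ≡-Reasoning
    primeToP-truncate : ∑< K (primeToP ∘ suc) ≡ ∑< K′ (primeToP ∘ suc)
    primeToP-truncate = ∑<-truncate (primeToP ∘ suc) (ℕD.∣⇒≤ {{ℕ.>-nonZero 0<K}} K′∣K) (λ i K′≤i →
      cong (_*ᶻ (𝟙 (¬? (p ∣? suc i)) *ᶻ μ (suc i)))
        (𝟙-no (suc i ∣? K′) (ℕD.>⇒∤ {{ℕ.>-nonZero (positive-factor K≡K′p 0<K)}} (s≤s K′≤i))))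
    multiples : ∑< K (λ i → 𝟙 (p ∣? suc i) *ᶻ divisorTerm (suc i)) ≡ - ∑< K′ (primeToP ∘ suc)
    multiples = trans (cong (λ k → ∑< k (λ i → 𝟙 (p ∣? suc i) *ᶻ divisorTerm (suc i))) K≡K′p)
      (trans (∑<-multiples (suc q) divisorTerm K′)
      (trans (∑<-cong K′ (λ e _ → multiple (suc e) (s≤s z≤n))) (∑<-neg K′ (primeToP ∘ suc))))

μ-divisorSum : ∀ K → 0 < K → divisorSum K μ ≡ 𝟙 (K ℕP.≟ 1)
μ-divisorSum (suc zero) _ = refl
μ-divisorSum (suc (suc K)) 0<K with leastFactor (suc (suc K)) (s≤s (s≤s z≤n))
... | q , divides K′ K≡K′p , nf = μ-divisorSum-composite (suc (suc K)) q K′ K≡K′p nf 0<K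

-- Aperiodic words and Möbius inversion over periods

Aperiodic : List A → Set
Aperiodic v = ∀ g → 0 < g → g < length v → ¬ IsPeriod g v

aperiodic? : DecidableEquality A → Decidable (Aperiodic {A})
aperiodic? _≟_ v with any<? (λ g → 0 < g × IsPeriod g v) (λ g → (0 ℕP.<? g) ×-dec isPeriod? _≟_ g v) (length v)
... | yes (g , g< , 0<g , pg) = no (λ ap → ap g 0<g g< pg)
... | no none = yes (λ g 0<g g< pg → none (g , g< , 0<g , pg))

module _ {v : List A} (mp : MinimalPeriod v) {K : ℕ} (len≡Kp : length v ≡ K * MinimalPeriod.period mp) where
  open MinimalPeriod mp

  private
    instance
      period≢0 : NonZero period
      period≢0 = ℕ.>-nonZero period>0

  aperiodic⇒K≡1 : 0 < length v → Aperiodic v → K ≡ 1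
  aperiodic⇒K≡1 0<len ap = go K len≡Kp
    where
    go : ∀ k → length v ≡ k * period → k ≡ 1
    go zero len≡0 = ⊥-elim (ℕP.<-irrefl (sym len≡0) 0<len)
    go (suc zero) _ = refl
    go (suc (suc k)) len≡ = ⊥-elim (ap period period>0
      (subst (period <_) (sym len≡) (ℕP.m<m+n period (ℕP.<-≤-trans period>0 (ℕP.m≤n*m period (suc k))))) isPeriod)

  K≡1⇒aperiodic : K ≡ 1 → Aperiodic v
  K≡1⇒aperiodic refl g 0<g g<len pg = ℕP.<-irrefl refl (ℕP.<-≤-trans
    (subst (g <_) (trans len≡Kp (ℕP.+-identityʳ period)) g<len) (ℕD.∣⇒≤ {{ℕ.>-nonZero 0<g}} (divides-periods g pg)))

  module _ {a ω : ℕ} .{{_ : NonZero ω}} (len≡aω : length v ≡ a * ω) where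

    isPeriod-cofactor⇒∣ : IsPeriod a v → ω ∣ K
    isPeriod-cofactor⇒∣ pa with divides-periods a pa
    ... | divides b refl = divides b (ℕP.*-cancelʳ-≡ K (b * ω) period (begin
      K * period          ≡⟨ trans (sym len≡Kp) len≡aω ⟩
      b * period * ω      ≡⟨ ℕP.*-assoc b period ω ⟩
      b * (period * ω)    ≡⟨ cong (b *_) (ℕP.*-comm period ω) ⟩
      b * (ω * period)    ≡⟨ sym (ℕP.*-assoc b ω period) ⟩
      b * ω * period      ∎))
      where open ≡-Reasoning

    ∣⇒isPeriod-cofactor : ω ∣ K → IsPeriod a v
    ∣⇒isPeriod-cofactor (divides c refl) = isPeriod-∣ isPeriod (divides c (ℕP.*-cancelʳ-≡ a (c * period) ω (begin
      a * ω               ≡⟨ trans (sym len≡aω) len≡Kp ⟩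
      c * ω * period      ≡⟨ ℕP.*-assoc c ω period ⟩
      c * (ω * period)    ≡⟨ cong (c *_) (ℕP.*-comm ω period) ⟩
      c * (period * ω)    ≡⟨ sym (ℕP.*-assoc c period ω) ⟩
      c * period * ω      ∎)))
      where open ≡-Reasoning

-- A word of length l with minimal period p = l / K has l / ω as a period exactly when ω ∣ K,
-- so the sum collapses to ∑_{ω ∣ K} μ(ω) = [K = 1] = [v aperiodic].
𝟙-aperiodic : (_≟_ : DecidableEquality A) → ∀ l (v : List A) → 0 < l → length v ≡ l →
  𝟙 (aperiodic? _≟_ v) ≡ ∑< l (λ i → 𝟙 (suc i ∣? l) *ᶻ (𝟙 (isPeriod? _≟_ (l / suc i) v) *ᶻ μ (suc i)))
𝟙-aperiodic _≟_ l v 0<l len with minimalPeriod _≟_ v (subst (0 <_) (sym len) 0<l)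
... | mp with MinimalPeriod.divides-length mp
...   | divides K len≡Kp = begin
  𝟙 (aperiodic? _≟_ v)
    ≡⟨ 𝟙-cong (aperiodic? _≟_ v) (K ℕP.≟ 1) (aperiodic⇒K≡1 mp len≡Kp 0<len) (K≡1⇒aperiodic mp len≡Kp) ⟩
  𝟙 (K ℕP.≟ 1)
    ≡⟨ sym (μ-divisorSum K 0<K) ⟩
  divisorSum K μ
    ≡⟨ sym (∑<-truncate _ K≤l beyondK) ⟩
  ∑< l (λ i → 𝟙 (suc i ∣? K) *ᶻ μ (suc i))
    ≡⟨ sym (∑<-cong l (λ i _ → term i)) ⟩
  ∑< l (λ i → 𝟙 (suc i ∣? l) *ᶻ (𝟙 (isPeriod? _≟_ (l / suc i) v) *ᶻ μ (suc i))) ∎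
  where
  open ≡-Reasoning
  0<len = subst (0 <_) (sym len) 0<l
  l≡Kp : l ≡ K * MinimalPeriod.period mp
  l≡Kp = trans (sym len) len≡Kp
  0<K : 0 < K
  0<K = positive-factor l≡Kp 0<l
  K∣l : K ∣ l
  K∣l = divides (MinimalPeriod.period mp) (trans l≡Kp (ℕP.*-comm K _))
  K≤l : K ≤ l
  K≤l = ℕD.∣⇒≤ {{ℕ.>-nonZero 0<l}} K∣l
  beyondK : ∀ i → K ≤ i → 𝟙 (suc i ∣? K) *ᶻ μ (suc i) ≡ + 0
  beyondK i K≤i = cong (_*ᶻ μ (suc i))
    (𝟙-no (suc i ∣? K) (ℕD.>⇒∤ {{ℕ.>-nonZero 0<K}} (s≤s K≤i)))
  term : ∀ i → 𝟙 (suc i ∣? l) *ᶻ (𝟙 (isPeriod? _≟_ (l / suc i) v) *ᶻ μ (suc i)) ≡ 𝟙 (suc i ∣? K) *ᶻ μ (suc i)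
  term i with suc i ∣? l
  ... | no i∤l = sym (cong (_*ᶻ μ (suc i)) (𝟙-no (suc i ∣? K) (λ i∣K → i∤l (ℕD.∣-trans i∣K K∣l))))
  ... | yes (divides a l≡a*ω) = trans (ℤP.*-identityˡ _) (cong (_*ᶻ μ (suc i))
      (𝟙-cong (isPeriod? _≟_ (l / suc i) v) (suc i ∣? K)
        (λ p → isPeriod-cofactor⇒∣ mp len≡Kp {a = a} len≡aω (subst (λ g → IsPeriod g v) l/ω≡a p))
        (λ ω∣K → subst (λ g → IsPeriod g v) (sym l/ω≡a) (∣⇒isPeriod-cofactor mp len≡Kp {a = a} len≡aω ω∣K))))
    where
    l/ω≡a : l / suc i ≡ a
    l/ω≡a = trans (ℕDM./-congˡ l≡a*ω) (ℕDM.m*n/n≡m a (suc i))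
    len≡aω : length v ≡ a * suc i
    len≡aω = trans len l≡a*ω

-- Counting orbits

module Multiplicity {A : Set} (_≟_ : DecidableEquality A) where

  multiplicity : A → List A → ℕ
  multiplicity t [] = 0
  multiplicity t (x ∷ xs) with x ≟ t
  ... | yes _ = suc (multiplicity t xs)
  ... | no _ = multiplicity t xs

  sumOver-𝟙≟ : (t : A) (xs : List A) → sumOver xs (λ x → 𝟙 (x ≟ t)) ≡ + multiplicity t xs
  sumOver-𝟙≟ t [] = refl
  sumOver-𝟙≟ t (x ∷ xs) with x ≟ t
  ... | yes _ = cong (+ 1 +ᶻ_) (sumOver-𝟙≟ t xs)
  ... | no _ = trans (ℤP.+-identityˡ _) (sumOver-𝟙≟ t xs)

  ∈⇒multiplicity>0 : {t : A} (xs : List A) → t ∈ xs → 0 < multiplicity t xs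
  ∈⇒multiplicity>0 {t} (x ∷ xs) t∈ with x ≟ t | t∈
  ... | yes _ | _ = s≤s z≤n
  ... | no x≢t | here t≡x = ⊥-elim (x≢t (sym t≡x))
  ... | no _ | there t∈xs = ∈⇒multiplicity>0 xs t∈xs

  index-unique : {t : A} (xs : List A) → multiplicity t xs ≡ 1 → (p q : t ∈ xs) → index p ≡ index q
  index-unique {t} (x ∷ xs) once p q with x ≟ t | p | q
  ... | _ | here _ | here _ = refl
  ... | yes _ | here _ | there q′ = ⊥-elim (ℕP.<-irrefl (sym (ℕP.suc-injective once)) (∈⇒multiplicity>0 xs q′))
  ... | yes _ | there p′ | _ = ⊥-elim (ℕP.<-irrefl (sym (ℕP.suc-injective once)) (∈⇒multiplicity>0 xs p′))
  ... | no x≢t | here t≡x | _ = ⊥-elim (x≢t (sym t≡x))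
  ... | no x≢t | _ | here t≡x = ⊥-elim (x≢t (sym t≡x))
  ... | no _ | there p′ | there q′ = cong fsuc (index-unique xs once p′ q′)

  multiplicity-filter : {P : A → Set} (P? : Decidable P) {t : A} (xs : List A) → P t →
    multiplicity t (filter P? xs) ≡ multiplicity t xs
  multiplicity-filter P? [] pt = refl
  multiplicity-filter P? {t} (y ∷ xs) pt with P? y
  ... | yes _ with y ≟ t
  ...   | yes _ = cong suc (multiplicity-filter P? xs pt)
  ...   | no _ = multiplicity-filter P? xs pt
  multiplicity-filter P? {t} (y ∷ xs) pt | no ¬py with y ≟ t
  ...   | yes refl = ⊥-elim (¬py pt)
  ...   | no _ = multiplicity-filter P? xs pt

  ∈-lookup-index : (xs : List A) (i : Fin (length xs)) → Σ (lookup xs i ∈ xs) (λ p → index p ≡ i)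
  ∈-lookup-index (x ∷ xs) fzero = here refl , refl
  ∈-lookup-index (x ∷ xs) (fsuc i) = there (proj₁ (∈-lookup-index xs i)) , cong fsuc (proj₂ (∈-lookup-index xs i))

find-just : {P : A → Set} (P? : Decidable P) (xs : List A) {y : A} → y ∈ xs → P y →
  Σ A λ r → find P? xs ≡ just r × r ∈ xs × P r
find-just P? (x ∷ xs) y∈ py with P? x | y∈
... | yes px | _ = x , refl , here refl , px
... | no ¬px | here refl = ⊥-elim (¬px py)
... | no _ | there y∈xs with find-just P? xs y∈xs py
...   | r , found , r∈ , pr = r , found , there r∈ , pr

find-cong : {P P′ : A → Set} (P? : Decidable P) (P′? : Decidable P′) (xs : List A) →
  (∀ y → y ∈ xs → P y → P′ y) → (∀ y → y ∈ xs → P′ y → P y) → find P? xs ≡ find P′? xs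
find-cong P? P′? [] f g = refl
find-cong P? P′? (x ∷ xs) f g with P? x | P′? x
... | yes _ | yes _ = refl
... | yes px | no ¬p′x = ⊥-elim (¬p′x (f x (here refl) px))
... | no ¬px | yes p′x = ⊥-elim (¬px (g x (here refl) p′x))
... | no _ | no _ = find-cong P? P′? xs (λ y y∈ → f y (there y∈)) (λ y y∈ → g y (there y∈))

∑<-𝟙-injective : (_≟_ : DecidableEquality A) (f : ℕ → A) (x : A) → ∀ N →
  (∀ i j → i < N → j < N → f i ≡ f j → i ≡ j) →
  ∑< N (λ i → 𝟙 (f i ≟ x)) ≡ 𝟙 (any<? (λ k → f k ≡ x) (λ k → f k ≟ x) N)
∑<-𝟙-injective _≟_ f x zero inj = refl
∑<-𝟙-injective _≟_ f x (suc N) inj = trans (∑<-snoc N (λ i → 𝟙 (f i ≟ x)))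
  (trans (cong (_+ᶻ 𝟙 (f N ≟ x)) (∑<-𝟙-injective _≟_ f x N (λ i j i< j< → inj i j (ℕP.m≤n⇒m≤1+n i<) (ℕP.m≤n⇒m≤1+n j<))))
         last-step)
  where
  last-step : 𝟙 (any<? (λ k → f k ≡ x) (λ k → f k ≟ x) N) +ᶻ 𝟙 (f N ≟ x)
            ≡ 𝟙 (any<? (λ k → f k ≡ x) (λ k → f k ≟ x) (suc N))
  last-step with any<? (λ k → f k ≡ x) (λ k → f k ≟ x) N | f N ≟ x
  ... | yes (k , k<N , fk≡x) | yes fN≡x =
    ⊥-elim (ℕP.<-irrefl (inj k N (ℕP.m≤n⇒m≤1+n k<N) ℕP.≤-refl (trans fk≡x (sym fN≡x))) k<N)
  ... | yes _ | no _ = refl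
  ... | no _ | yes _ = refl
  ... | no _ | no _ = refl

Orbit : (A → ℕ → A) → ℕ → A → A → Set
Orbit act l x y = Σ ℕ λ k → k < l × act x k ≡ y

-- A finite set U, enumerated without repetition, carrying an action of ℤ/l whose orbits
-- inside the invariant subset Q all have exactly l elements: counting Q by orbits gives |Q| = l · #orbits.
module OrbitCounting {A : Set} (_≟_ : DecidableEquality A) (U : List A) (InU : A → Set)
  (InU⇒∈ : ∀ {x} → InU x → x ∈ U) (∈⇒InU : ∀ {x} → x ∈ U → InU x)
  (multiplicity-U : ∀ {x} → InU x → Multiplicity.multiplicity _≟_ x U ≡ 1)
  (l : ℕ) (0<l : 0 < l) (act : A → ℕ → A) (act-0 : ∀ x → act x 0 ≡ x)
  (Q : A → Set) (Q? : Decidable Q)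
  (orbit-sym : ∀ {x y} → InU x → Orbit act l x y → Orbit act l y x)
  (orbit-trans : ∀ {x y z} → InU x → Orbit act l x y → Orbit act l y z → Orbit act l x z)
  (orbit-InU : ∀ {x y} → InU x → Orbit act l x y → InU y)
  (orbit-Q : ∀ {x y} → InU x → Orbit act l x y → Q x → Q y)
  (act-injective : ∀ {x} → InU x → Q x → ∀ i j → i < l → j < l → act x i ≡ act x j → i ≡ j)
  where
  open Multiplicity _≟_

  R : A → A → Set
  R = Orbit act l

  R? : ∀ x y → Dec (R x y)
  R? x y = any<? (λ k → act x k ≡ y) (λ k → act x k ≟ y) l

  R-refl : ∀ x → R x x
  R-refl x = 0 , 0<l , act-0 x

  firstInOrbit : A → Maybe A
  firstInOrbit x = find (λ y → R? y x) U

  -- an orbit is represented by its first element in the enumeration U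
  IsRepresentative : A → Set
  IsRepresentative x = Q x × firstInOrbit x ≡ just x

  isRepresentative? : Decidable IsRepresentative
  isRepresentative? x = Q? x ×-dec MP.≡-dec _≟_ (firstInOrbit x) (just x)

  representatives : List A
  representatives = filter isRepresentative? U

  N : ℕ
  N = length representatives

  firstInOrbit-resp : ∀ {x y} → InU x → R x y → firstInOrbit x ≡ firstInOrbit y
  firstInOrbit-resp ix rxy = find-cong (λ z → R? z _) (λ z → R? z _) U
    (λ z z∈ rzx → orbit-trans (∈⇒InU z∈) rzx rxy) (λ z z∈ rzy → orbit-trans (∈⇒InU z∈) rzy (orbit-sym ix rxy))

  representative : ∀ {x} → InU x → Q x → Σ A λ r → r ∈ representatives × R r x
  representative {x} ix qx with find-just (λ y → R? y x) U (InU⇒∈ ix) (R-refl x)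
  ... | r , found , r∈U , rrx = r , MemP.∈-filter⁺ isRepresentative? r∈U (qr , trans (firstInOrbit-resp ir rrx) found) , rrx
    where
    ir = ∈⇒InU r∈U
    qr = orbit-Q ix (orbit-sym ir rrx) qx

  representative-valid : ∀ {r} → r ∈ representatives → InU r × IsRepresentative r
  representative-valid r∈ with MemP.∈-filter⁻ isRepresentative? {xs = U} r∈
  ... | r∈U , isRep = ∈⇒InU r∈U , isRep

  representative-unique : ∀ {r r′ x} → r ∈ representatives → R r x → r′ ∈ representatives → R r′ x → r ≡ r′
  representative-unique r∈ rx r′∈ r′x = MP.just-injective (begin
    just _           ≡⟨ sym (proj₂ (proj₂ (representative-valid r∈))) ⟩
    firstInOrbit _   ≡⟨ firstInOrbit-resp (proj₁ (representative-valid r∈)) rx ⟩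
    firstInOrbit _   ≡⟨ sym (firstInOrbit-resp (proj₁ (representative-valid r′∈)) r′x) ⟩
    firstInOrbit _   ≡⟨ proj₂ (proj₂ (representative-valid r′∈)) ⟩
    just _           ∎)
    where open ≡-Reasoning

  multiplicity-representatives : ∀ {r} → r ∈ representatives → multiplicity r representatives ≡ 1
  multiplicity-representatives r∈ = trans (multiplicity-filter isRepresentative? U (proj₂ (representative-valid r∈)))
                                          (multiplicity-U (proj₁ (representative-valid r∈)))

  private
    onOneOrbit : ∀ x → x ∈ U → 𝟙 (Q? x) ≡ 𝟙 (Q? x) *ᶻ sumOver representatives (λ r → 𝟙 (R? r x))
    onOneOrbit x x∈ with Q? x
    ... | no _ = refl
    ... | yes qx = sym (trans (ℤP.*-identityˡ _) (trans (sumOver-cong-∈ representatives same)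
        (trans (sumOver-𝟙≟ c representatives) (cong +_ (multiplicity-representatives c∈)))))
      where
      c = proj₁ (representative (∈⇒InU x∈) qx)
      c∈ = proj₁ (proj₂ (representative (∈⇒InU x∈) qx))
      crx = proj₂ (proj₂ (representative (∈⇒InU x∈) qx))
      same : ∀ r → r ∈ representatives → 𝟙 (R? r x) ≡ 𝟙 (r ≟ c)
      same r r∈ = 𝟙-cong (R? r x) (r ≟ c) (λ rx → representative-unique r∈ rx c∈ crx) (λ { refl → crx })

    orbitSize : ∀ r → r ∈ representatives → sumOver U (λ x → 𝟙 (Q? x) *ᶻ 𝟙 (R? r x)) ≡ + l
    orbitSize r r∈ = trans (sumOver-cong U inQ) (trans (sumOver-cong U asSum)
      (trans (sym (∑<-sumOver l U (λ i x → 𝟙 (act r i ≟ x)))) (trans (∑<-cong l hitsOnce) (∑<-const-1 l))))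
      where
      ir = proj₁ (representative-valid r∈)
      qr = proj₁ (proj₂ (representative-valid r∈))
      inQ : ∀ x → 𝟙 (Q? x) *ᶻ 𝟙 (R? r x) ≡ 𝟙 (R? r x)
      inQ x with R? r x
      ... | no _ = ℤP.*-zeroʳ (𝟙 (Q? x))
      ... | yes rx = cong (_*ᶻ + 1) (𝟙-yes (Q? x) (orbit-Q ir rx qr))
      asSum : ∀ x → 𝟙 (R? r x) ≡ ∑< l (λ i → 𝟙 (act r i ≟ x))
      asSum x = sym (∑<-𝟙-injective _≟_ (act r) x l (act-injective ir qr))
      hitsOnce : ∀ i → i < l → sumOver U (λ x → 𝟙 (act r i ≟ x)) ≡ + 1
      hitsOnce i i<l = trans (sumOver-cong U (λ x → 𝟙-cong (act r i ≟ x) (x ≟ act r i) sym sym))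
        (trans (sumOver-𝟙≟ (act r i) U) (cong +_ (multiplicity-U (orbit-InU ir (i , i<l , refl)))))

  sumOver-Q≡N*l : sumOver U (λ x → 𝟙 (Q? x)) ≡ + N *ᶻ + l
  sumOver-Q≡N*l = begin
    sumOver U (λ x → 𝟙 (Q? x))
      ≡⟨ sumOver-cong-∈ U onOneOrbit ⟩
    sumOver U (λ x → 𝟙 (Q? x) *ᶻ sumOver representatives (λ r → 𝟙 (R? r x)))
      ≡⟨ sumOver-cong U (λ x → sym (sumOver-*ˡ representatives (𝟙 (Q? x)) (λ r → 𝟙 (R? r x)))) ⟩
    sumOver U (λ x → sumOver representatives (λ r → 𝟙 (Q? x) *ᶻ 𝟙 (R? r x)))
      ≡⟨ sumOver-swap U representatives _ ⟩
    sumOver representatives (λ r → sumOver U (λ x → 𝟙 (Q? x) *ᶻ 𝟙 (R? r x)))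
      ≡⟨ sumOver-cong-∈ representatives orbitSize ⟩
    sumOver representatives (λ _ → + l)
      ≡⟨ sumOver-const representatives (+ l) ⟩
    + N *ᶻ + l ∎
    where open ≡-Reasoning

module Words (n : ℕ) where

  _≟ʷ_ : DecidableEquality (List (Fin n))
  _≟ʷ_ = LP.≡-dec Fin._≟_

  open Multiplicity _≟ʷ_ public

  words : ℕ → List (List (Fin n))
  words zero = [ [] ]
  words (suc m) = concatMap (λ x → map (x ∷_) (words m)) (allFin n)

  sumOver-words-suc : ∀ m (f : List (Fin n) → ℤ) →
    sumOver (words (suc m)) f ≡ sumOver (allFin n) (λ x → sumOver (words m) (λ v → f (x ∷ v)))
  sumOver-words-suc m f = trans (sumOver-concatMap (λ x → map (x ∷_) (words m)) (allFin n) f)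
    (sumOver-cong (allFin n) (λ x → sumOver-map (x ∷_) (words m) f))

  sumOver-words-+ : ∀ a b (f : List (Fin n) → ℤ) →
    sumOver (words (a + b)) f ≡ sumOver (words a) (λ u → sumOver (words b) (λ w → f (u ++ w)))
  sumOver-words-+ zero b f = sym (ℤP.+-identityʳ _)
  sumOver-words-+ (suc a) b f = trans (sumOver-words-suc (a + b) f)
    (trans (sumOver-cong (allFin n) (λ x → sumOver-words-+ a b (λ v → f (x ∷ v))))
           (sym (sumOver-words-suc a (λ u → sumOver (words b) (λ w → f (u ++ w))))))

  ∈-words : ∀ m (v : List (Fin n)) → length v ≡ m → v ∈ words m
  ∈-words zero [] _ = here refl
  ∈-words (suc m) (x ∷ v) len = MemP.∈-concatMap⁺ (λ y → map (y ∷_) (words m))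
    (Any.map (λ { refl → MemP.∈-map⁺ (x ∷_) (∈-words m v (ℕP.suc-injective len)) }) (MemP.∈-allFin x))

  length-∈-words : ∀ m (v : List (Fin n)) → v ∈ words m → length v ≡ m
  length-∈-words zero [] _ = refl
  length-∈-words zero (_ ∷ _) (here ())
  length-∈-words zero (_ ∷ _) (there ())
  length-∈-words (suc m) v v∈ with Any.satisfied (MemP.∈-concatMap⁻ (λ y → map (y ∷_) (words m)) {xs = allFin n} v∈)
  ... | y , v∈′ with MemP.∈-map⁻ (y ∷_) v∈′
  ...   | u , u∈ , refl = cong suc (length-∈-words m u u∈)

  sumOver-allFin-𝟙≟ : (y : Fin n) → sumOver (allFin n) (λ x → 𝟙 (x Fin.≟ y)) ≡ + 1
  sumOver-allFin-𝟙≟ y = trans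
    (sumOver-tabulate n (λ x → x) (λ x → 𝟙 (x Fin.≟ y)) (λ i → 𝟙 (toℕ y ℕP.≟ i) *ᶻ + 1)
       (λ x → trans (𝟙-cong (x Fin.≟ y) (toℕ y ℕP.≟ toℕ x) (λ { refl → refl }) (λ e → sym (FinP.toℕ-injective e)))
                    (sym (ℤP.*-identityʳ _))))
    (∑<-delta n (toℕ y) (λ _ → + 1) (FinP.toℕ<n y))

  sumOver-words-𝟙≟ : ∀ m (t : List (Fin n)) → length t ≡ m → sumOver (words m) (λ v → 𝟙 (v ≟ʷ t)) ≡ + 1
  sumOver-words-𝟙≟ zero [] _ = refl
  sumOver-words-𝟙≟ (suc m) (y ∷ t) len = trans (sumOver-words-suc m _)
    (trans (sumOver-cong (allFin n) headMatches) (sumOver-allFin-𝟙≟ y))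
    where
    𝟙-∷ : ∀ x v → 𝟙 ((x ∷ v) ≟ʷ (y ∷ t)) ≡ 𝟙 (x Fin.≟ y) *ᶻ 𝟙 (v ≟ʷ t)
    𝟙-∷ x v = trans (𝟙-cong ((x ∷ v) ≟ʷ (y ∷ t)) ((x Fin.≟ y) ×-dec (v ≟ʷ t))
                      (λ e → LP.∷-injective e) (λ { (refl , refl) → refl }))
                    (𝟙-× (x Fin.≟ y) (v ≟ʷ t))
    headMatches : ∀ x → sumOver (words m) (λ v → 𝟙 ((x ∷ v) ≟ʷ (y ∷ t))) ≡ 𝟙 (x Fin.≟ y)
    headMatches x = trans (sumOver-cong (words m) (𝟙-∷ x))
      (trans (sumOver-*ˡ (words m) (𝟙 (x Fin.≟ y)) (λ v → 𝟙 (v ≟ʷ t)))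
      (trans (cong (𝟙 (x Fin.≟ y) *ᶻ_) (sumOver-words-𝟙≟ m t (ℕP.suc-injective len))) (ℤP.*-identityʳ _)))

  multiplicity-words : ∀ m (t : List (Fin n)) → length t ≡ m → multiplicity t (words m) ≡ 1
  multiplicity-words m t len = ℤP.+-injective (trans (sym (sumOver-𝟙≟ t (words m))) (sumOver-words-𝟙≟ m t len))

module Walks {V : Set} (_⟶_ : V → V → Set) where

  -- Walk x v y: a walk from x to y whose inner vertices are v
  Walk : V → List V → V → Set
  Walk x [] y = x ⟶ y
  Walk x (z ∷ v) y = x ⟶ z × Walk z v y

  Closed : List V → Set
  Closed [] = ⊥
  Closed (x ∷ v) = Walk x v x

  module _ (_⟶?_ : ∀ x y → Dec (x ⟶ y)) where

    walk? : ∀ x v y → Dec (Walk x v y)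
    walk? x [] y = x ⟶? y
    walk? x (z ∷ v) y = (x ⟶? z) ×-dec walk? z v y

    closed? : ∀ c → Dec (Closed c)
    closed? [] = no (λ ())
    closed? (x ∷ v) = walk? x v x

  linked⇒walk : ∀ x v y → Linked _⟶_ (x ∷ v ++ [ y ]) → Walk x v y
  linked⇒walk x [] y (x⟶y ∷ [-]) = x⟶y
  linked⇒walk x (z ∷ v) y (x⟶z ∷ rest) = x⟶z , linked⇒walk z v y rest

  walk⇒linked : ∀ x v y → Walk x v y → Linked _⟶_ (x ∷ v ++ [ y ])
  walk⇒linked x [] y x⟶y = x⟶y ∷ [-]
  walk⇒linked x (z ∷ v) y (x⟶z , w) = x⟶z ∷ walk⇒linked z v y w

  walk-prefix : ∀ x v y v′ z → Walk x (v ++ y ∷ v′) z → Walk x v y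
  walk-prefix x [] y v′ z (x⟶y , _) = x⟶y
  walk-prefix x (u ∷ v) y v′ z (x⟶u , w) = x⟶u , walk-prefix u v y v′ z w

  walk-++ : ∀ x v y v′ z → Walk x v y → Walk y v′ z → Walk x (v ++ y ∷ v′) z
  walk-++ x [] y v′ z x⟶y w = x⟶y , w
  walk-++ x (u ∷ v) y v′ z (x⟶u , w) w′ = x⟶u , walk-++ u v y v′ z w w′

  walk-snoc : ∀ x v y z → Walk x v y → y ⟶ z → Walk x (v ++ [ y ]) z
  walk-snoc x [] y z x⟶y y⟶z = x⟶y , y⟶z
  walk-snoc x (u ∷ v) y z (x⟶u , w) y⟶z = x⟶u , walk-snoc u v y z w y⟶z

  closed-rotate : ∀ c → Closed c → Closed (rotate c)
  closed-rotate (x ∷ []) x⟶x = x⟶x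
  closed-rotate (x ∷ z ∷ v) (x⟶z , w) = walk-snoc z v x z w x⟶z

  closed-rotate^ : ∀ k c → Closed c → Closed (rotate^ k c)
  closed-rotate^ zero c cc = cc
  closed-rotate^ (suc k) c cc = closed-rotate^ k (rotate c) (closed-rotate c cc)

  closed-power⇒closed : ∀ x u q → Closed (power (x ∷ u) (suc q)) → Closed (x ∷ u)
  closed-power⇒closed x u zero cc = subst (λ v → Walk x v x) (LP.++-identityʳ u) cc
  closed-power⇒closed x u (suc q) cc = walk-prefix x u x (u ++ power (x ∷ u) q) x cc

  closed⇒closed-power : ∀ x u q → Closed (x ∷ u) → Closed (power (x ∷ u) (suc q))
  closed⇒closed-power x u zero cc = subst (λ v → Walk x v x) (sym (LP.++-identityʳ u)) cc
  closed⇒closed-power x u (suc q) cc =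
    walk-++ x u x (u ++ power (x ∷ u) q) x cc (closed⇒closed-power x u q cc)

  -- the vertex list v₀ … v_{l-1} v₀ of the circuit given by the cyclic word v₀ … v_{l-1}
  closeUp : List V → List V
  closeUp c = c ++ take 1 c

  dropLast-snoc : ∀ (xs : List V) y → dropLast (xs ++ [ y ]) ≡ xs
  dropLast-snoc [] y = refl
  dropLast-snoc (x ∷ []) y = refl
  dropLast-snoc (x ∷ x′ ∷ xs) y = cong (x ∷_) (dropLast-snoc (x′ ∷ xs) y)

  dropLast-closeUp : ∀ c → dropLast (closeUp c) ≡ c
  dropLast-closeUp [] = refl
  dropLast-closeUp (x ∷ v) = dropLast-snoc (x ∷ v) x

  dropLast-++-last : ∀ x (ys : List V) z → last (x ∷ ys) ≡ just z → x ∷ ys ≡ dropLast (x ∷ ys) ++ [ z ]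
  dropLast-++-last x [] z e = cong [_] (MP.just-injective e)
  dropLast-++-last x (y ∷ ys) z e = cong (x ∷_) (dropLast-++-last y ys z e)

  last-snoc : ∀ (xs : List V) y → last (xs ++ [ y ]) ≡ just y
  last-snoc [] y = refl
  last-snoc (x ∷ []) y = refl
  last-snoc (x ∷ x′ ∷ xs) y = last-snoc (x′ ∷ xs) y

  rot-closeUp : ∀ c → 0 < length c → rot (closeUp c) ≡ closeUp (rotate c)
  rot-closeUp (x ∷ []) _ = refl
  rot-closeUp (x ∷ y ∷ v) _ = refl

  rot^-closeUp : ∀ k c → 0 < length c → rot^ k (closeUp c) ≡ closeUp (rotate^ k c)
  rot^-closeUp zero c _ = refl
  rot^-closeUp (suc k) c 0<c = trans (cong rot (rot^-closeUp k c 0<c))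
    (trans (rot-closeUp (rotate^ k c) (subst (0 <_) (sym (length-rotate^ k c)) 0<c))
           (cong closeUp (sym (rotate^-suc k c))))

  repeatCircuit-closeUp : ∀ m x u → repeatCircuit m (closeUp (x ∷ u)) ≡ power (x ∷ u) m ++ [ x ]
  repeatCircuit-closeUp m x u = cong (λ z → power z m ++ [ x ]) (dropLast-closeUp (x ∷ u))

-- Closed walks of length k from a fixed vertex: k C j of them use j steps of length a₁ + d.
closedWalksFrom : (n a₁ d k : ℕ) → ℤ
closedWalksFrom n a₁ d k = ∑< (suc k) (λ j → + (k C j) *ᶻ 𝟙 (n ∣? k * a₁ + j * d))

-- Primitive periodic orbits of the circulant graph as aperiodic closed words

module Circulant (n a₁ d : ℕ) {{_ : NonZero n}} where

  open Words n public
  open Walks (Bond n a₁ d) public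

  bond? : ∀ u v → Dec (Bond n a₁ d u v)
  bond? u v = (toℕ v ℕP.≟ (toℕ u + a₁) % n) ⊎-dec (toℕ v ℕP.≟ (toℕ u + (a₁ + d)) % n)

  closedWord? : ∀ c → Dec (Closed c)
  closedWord? = closed? bond?

  PrimitiveClosed : List (Fin n) → Set
  PrimitiveClosed c = Closed c × Aperiodic c

  primitiveClosed? : Decidable PrimitiveClosed
  primitiveClosed? c = closedWord? c ×-dec aperiodic? Fin._≟_ c

  closeUp-circuit : ∀ l c → 0 < l → length c ≡ l → Closed c → Circuit n a₁ d l (closeUp c)
  closeUp-circuit l (x ∷ v) 0<l len cc =
    0<l , trans (LP.length-++ (x ∷ v)) (trans (ℕP.+-comm (length (x ∷ v)) 1) (cong suc len)) ,
    walk⇒linked x v x cc , sym (last-snoc (x ∷ v) x)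

  circuit⇒closeUp : ∀ l vs → Circuit n a₁ d l vs →
    vs ≡ closeUp (dropLast vs) × length (dropLast vs) ≡ l × Closed (dropLast vs)
  circuit⇒closeUp l (x ∷ []) (0<l , len , _) with ℕP.suc-injective len
  circuit⇒closeUp .0 (x ∷ []) (() , _) | refl
  circuit⇒closeUp l (x ∷ y ∷ ys) (_ , len , linked , head≡last) =
    vs≡ , len′ , linked⇒walk x c x (subst (Linked (Bond n a₁ d)) vs≡ linked)
    where
    c = dropLast (y ∷ ys)
    vs≡ : x ∷ y ∷ ys ≡ closeUp (x ∷ c)
    vs≡ = dropLast-++-last x (y ∷ ys) x (sym head≡last)
    len′ : length (x ∷ c) ≡ l
    len′ = ℕP.suc-injective (trans (trans (ℕP.+-comm 1 (length (x ∷ c))) (sym (LP.length-++ (x ∷ c) {[ x ]})))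
                                   (trans (cong length (sym vs≡)) len))

  aperiodic⇒Primitive : ∀ l c → length c ≡ l → Aperiodic c → Primitive n a₁ d l (closeUp c)
  aperiodic⇒Primitive l c len ap (k , m , w , circuit , k<l , c≡w^m) with circuit⇒closeUp k w circuit
  ... | w≡ , len-u , _ = noShorterPeriod (dropLast w) len-u w≡
    where
    noShorterPeriod : ∀ u → length u ≡ k → w ≡ closeUp u → ⊥
    noShorterPeriod [] len-u _ = ℕP.<-irrefl len-u (proj₁ circuit)
    noShorterPeriod (x ∷ u) len-u w≡ = ap k (proj₁ circuit) (subst (k <_) (sym len) k<l)
      (subst (λ g → IsPeriod g c) len-u (subst (IsPeriod (length (x ∷ u))) (sym c≡) (isPeriod-power (x ∷ u) m)))
      where
      c≡ : c ≡ power (x ∷ u) m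
      c≡ = trans (sym (dropLast-closeUp c)) (trans (cong dropLast
             (trans c≡w^m (trans (cong (repeatCircuit m) w≡) (repeatCircuit-closeUp m x u))))
             (dropLast-snoc (power (x ∷ u) m) x))

  Primitive⇒aperiodic : ∀ l c → 0 < l → length c ≡ l → Closed c → Primitive n a₁ d l (closeUp c) → Aperiodic c
  Primitive⇒aperiodic l c 0<l len cc prim g 0<g g<len pg with minimalPeriod Fin._≟_ c 0<len
    where 0<len = subst (0 <_) (sym len) 0<l
  ... | mp with MinimalPeriod.divides-length mp
  ...   | divides zero len≡0 = ℕP.<-irrefl (trans (sym len≡0) len) 0<l
  ...   | divides (suc q) len≡ = shorterPeriod (take p c) shorter c≡
    where
    open MinimalPeriod mp renaming (period to p)
    p≤g : p ≤ g
    p≤g = ℕD.∣⇒≤ {{ℕ.>-nonZero 0<g}} (divides-periods g pg)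
    shorter : length (take p c) < l
    shorter = subst (_< l) (sym (trans (LP.length-take p c) (ℕP.m≤n⇒m⊓n≡m (ℕP.≤-trans p≤g (ℕP.<⇒≤ g<len)))))
                (ℕP.≤-<-trans p≤g (subst (g <_) len g<len))
    c≡ : c ≡ power (take p c) (suc q)
    c≡ = isPeriod⇒power q p c len≡ isPeriod
    shorterPeriod : ∀ u → length u < l → c ≡ power u (suc q) → ⊥
    shorterPeriod [] _ c≡ = ℕP.<-irrefl (sym (trans (sym len) (trans (cong length c≡)
      (trans (length-power [] (suc q)) (ℕP.*-zeroʳ (suc q)))))) 0<l
    shorterPeriod (x ∷ u) u<l c≡ = prim (length (x ∷ u) , suc q , closeUp (x ∷ u) ,
      closeUp-circuit _ (x ∷ u) (s≤s z≤n) refl (closed-power⇒closed x u q (subst Closed c≡ cc)) ,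
      u<l , trans (cong closeUp c≡) (sym (repeatCircuit-closeUp (suc q) x u)))

  module PrimitiveOrbits (l : ℕ) (0<l : 0 < l) where

    private
      instance
        l≢0 : NonZero l
        l≢0 = ℕ.>-nonZero 0<l

    HasLength : List (Fin n) → Set
    HasLength c = length c ≡ l

    act : List (Fin n) → ℕ → List (Fin n)
    act c i = rotate^ i c

    isPeriod-l : ∀ {c} → HasLength c → IsPeriod l c
    isPeriod-l {c} len = subst (λ g → IsPeriod g c) len (isPeriod-length c)

    rotate^-% : ∀ {c} k → HasLength c → rotate^ k c ≡ rotate^ (k % l) c
    rotate^-% {c} k len = trans (cong (λ j → rotate^ j c) (ℕDM.m≡m%n+[m/n]*n k l))
      (trans (rotate^-+ (k % l) ((k / l) * l) c)
             (isPeriod-* (k / l) (isPeriod-l {rotate^ (k % l) c} (trans (length-rotate^ (k % l) c) len))))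

    orbit-sym : ∀ {x y} → HasLength x → Orbit act l x y → Orbit act l y x
    orbit-sym {x} len (zero , _ , refl) = 0 , 0<l , refl
    orbit-sym {x} len (suc k , k<l , refl) = l ∸ suc k , ℕP.∸-monoʳ-< {l} {suc k} {0} (s≤s z≤n) (ℕP.<⇒≤ k<l) ,
      trans (sym (rotate^-+ (suc k) (l ∸ suc k) x))
            (trans (cong (λ j → rotate^ j x) (ℕP.m+[n∸m]≡n (ℕP.<⇒≤ k<l))) (isPeriod-l len))

    orbit-trans : ∀ {x y z} → HasLength x → Orbit act l x y → Orbit act l y z → Orbit act l x z
    orbit-trans {x} len (j , _ , refl) (k , _ , refl) = (j + k) % l , ℕDM.m%n<n (j + k) l ,
      trans (sym (rotate^-% (j + k) len)) (rotate^-+ j k x)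

    orbit-HasLength : ∀ {x y} → HasLength x → Orbit act l x y → HasLength y
    orbit-HasLength {x} len (k , _ , refl) = trans (length-rotate^ k x) len

    orbit-primitiveClosed : ∀ {x y} → HasLength x → Orbit act l x y → PrimitiveClosed x → PrimitiveClosed y
    orbit-primitiveClosed {x} {y} len xy@(k , _ , refl) (cx , apx) = closed-rotate^ k x cx ,
      λ g 0<g g<len pg → apx g 0<g (subst (g <_) (trans (orbit-HasLength len xy) (sym len)) g<len)
        (subst (IsPeriod g) (proj₂ (proj₂ yx)) (isPeriod-rotate^ g (proj₁ yx) pg))
      where
      yx = orbit-sym len xy

    -- equal rotations by i < j < l would make i + (l - j) a period shorter than l
    rotate^-distinct : ∀ {x i j} → HasLength x → Aperiodic x → i < j → j < l → act x i ≢ act x j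
    rotate^-distinct {x} {i} {j} len apx i<j j<l e = apx (i + (l ∸ j))
      (ℕP.<-≤-trans (ℕP.m<n⇒0<n∸m j<l) (ℕP.m≤n+m (l ∸ j) i))
      (subst (i + (l ∸ j) <_) (trans (ℕP.m+[n∸m]≡n (ℕP.<⇒≤ j<l)) (sym len)) (ℕP.+-monoˡ-< (l ∸ j) i<j))
      (trans (rotate^-+ i (l ∸ j) x) (trans (cong (rotate^ (l ∸ j)) e) (trans (sym (rotate^-+ j (l ∸ j) x))
        (trans (cong (λ k → rotate^ k x) (ℕP.m+[n∸m]≡n (ℕP.<⇒≤ j<l))) (isPeriod-l len)))))

    act-injective : ∀ {x} → HasLength x → PrimitiveClosed x → ∀ i j → i < l → j < l → act x i ≡ act x j → i ≡ j
    act-injective len (_ , apx) i j i<l j<l e with ℕP.<-cmp i j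
    ... | tri< i<j _ _ = ⊥-elim (rotate^-distinct len apx i<j j<l e)
    ... | tri≈ _ i≡j _ = i≡j
    ... | tri> _ _ j<i = ⊥-elim (rotate^-distinct len apx j<i i<l (sym e))

    open OrbitCounting _≟ʷ_ (words l) HasLength (λ {x} → ∈-words l x) (λ {x} → length-∈-words l x)
      (λ {x} → multiplicity-words l x) l 0<l act (λ _ → refl) PrimitiveClosed primitiveClosed?
      orbit-sym orbit-trans orbit-HasLength orbit-primitiveClosed act-injective public

    private
      index-resp : ∀ {r r′} (r∈ : r ∈ representatives) (r′∈ : r′ ∈ representatives) → r ≡ r′ → index r∈ ≡ index r′∈
      index-resp r∈ r′∈ refl = index-unique representatives (multiplicity-representatives r∈) r∈ r′∈

      cyclicWord : PrimCircuit n a₁ d l → List (Fin n)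
      cyclicWord x = dropLast (proj₁ x)

      cyclicWord-valid : (x : PrimCircuit n a₁ d l) → HasLength (cyclicWord x) × PrimitiveClosed (cyclicWord x)
      cyclicWord-valid (vs , circuit , prim) with circuit⇒closeUp l vs circuit
      ... | vs≡ , len , cc = len , cc , Primitive⇒aperiodic l (dropLast vs) 0<l len cc (subst (Primitive n a₁ d l) vs≡ prim)

      closeUp-cyclicWord : (x : PrimCircuit n a₁ d l) → closeUp (cyclicWord x) ≡ proj₁ x
      closeUp-cyclicWord x = sym (proj₁ (circuit⇒closeUp l (proj₁ x) (proj₁ (proj₂ x))))

      representativeOf : (x : PrimCircuit n a₁ d l) → Σ (List (Fin n)) λ r → r ∈ representatives × R r (cyclicWord x)
      representativeOf x = representative (proj₁ (cyclicWord-valid x)) (proj₂ (cyclicWord-valid x))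

      toCircuit : Fin N → PrimCircuit n a₁ d l
      toCircuit i = closeUp r , closeUp-circuit l r 0<l len (proj₁ pc) , aperiodic⇒Primitive l r len (proj₂ pc)
        where
        r = lookup representatives i
        valid = representative-valid (proj₁ (∈-lookup-index representatives i))
        len = proj₁ valid
        pc = proj₁ (proj₂ valid)

      fromCircuit : PrimCircuit n a₁ d l → Fin N
      fromCircuit x = index (proj₁ (proj₂ (representativeOf x)))

      ≈PO⇒R : ∀ x y → x ≈PO y → R (cyclicWord x) (cyclicWord y)
      ≈PO⇒R x y (k , rot^x≡y) = k % l , ℕDM.m%n<n k l , trans (sym (rotate^-% k len)) rotated
        where
        len = proj₁ (cyclicWord-valid x)
        0<len = subst (0 <_) (sym len) 0<l
        rotated : rotate^ k (cyclicWord x) ≡ cyclicWord y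
        rotated = trans (sym (dropLast-closeUp _)) (trans (cong dropLast
          (trans (sym (rot^-closeUp k (cyclicWord x) 0<len))
          (trans (cong (rot^ k) (closeUp-cyclicWord x)) (trans rot^x≡y (sym (closeUp-cyclicWord y))))))
          (dropLast-closeUp (cyclicWord y)))

    numPrimOrbits : NumPrimOrbits n a₁ d l N
    numPrimOrbits = record
      { to = toCircuit
      ; from = fromCircuit
      ; from-resp = λ {x} {y} → from-resp x y
      ; from-to = from-to
      ; to-from = to-from
      }
      where
      from-resp : ∀ x y → x ≈PO y → fromCircuit x ≡ fromCircuit y
      from-resp x y x≈y = index-resp rx∈ ry∈ (representative-unique rx∈
          (orbit-trans (proj₁ (representative-valid rx∈)) (proj₂ (proj₂ (representativeOf x))) (≈PO⇒R x y x≈y))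
          ry∈ (proj₂ (proj₂ (representativeOf y))))
        where
        rx∈ = proj₁ (proj₂ (representativeOf x))
        ry∈ = proj₁ (proj₂ (representativeOf y))
      from-to : ∀ i → fromCircuit (toCircuit i) ≡ i
      from-to i = trans (index-resp (proj₁ (proj₂ rep)) r∈ (representative-unique (proj₁ (proj₂ rep)) rep-r r∈ (R-refl r)))
                        (proj₂ (∈-lookup-index representatives i))
        where
        r = lookup representatives i
        r∈ = proj₁ (∈-lookup-index representatives i)
        rep = representativeOf (toCircuit i)
        rep-r : R (proj₁ rep) r
        rep-r = subst (R (proj₁ rep)) (dropLast-closeUp r) (proj₂ (proj₂ rep))
      to-from : ∀ x → toCircuit (fromCircuit x) ≈PO x
      to-from x = k , trans (cong (λ c → rot^ k (closeUp c)) (sym (AnyP.lookup-index r∈)))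
          (trans (rot^-closeUp k r 0<r) (trans (cong closeUp r→x) (closeUp-cyclicWord x)))
        where
        rep = representativeOf x
        r = proj₁ rep
        r∈ = proj₁ (proj₂ rep)
        k = proj₁ (proj₂ (proj₂ rep))
        r→x = proj₂ (proj₂ (proj₂ (proj₂ rep)))
        0<r : 0 < length r
        0<r = subst (0 <_) (sym (proj₁ (representative-valid r∈))) 0<l

  𝟙-closed-power : ∀ u q → 0 < length u → 𝟙 (closedWord? (power u (suc q))) ≡ 𝟙 (closedWord? u)
  𝟙-closed-power (x ∷ u) q _ = 𝟙-cong (closedWord? (power (x ∷ u) (suc q))) (closedWord? (x ∷ u))
    (closed-power⇒closed x u q) (closed⇒closed-power x u q)

  -- a closed word of length (q + 1) g with period g is the (q + 1)-st power of a closed word of length g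
  sumOver-closed-isPeriod : ∀ g q → 0 < g →
    sumOver (words (suc q * g)) (λ v → 𝟙 (closedWord? v) *ᶻ 𝟙 (isPeriod? Fin._≟_ g v))
      ≡ sumOver (words g) (λ u → 𝟙 (closedWord? u))
  sumOver-closed-isPeriod g q 0<g = trans (sumOver-words-+ g (q * g) _) (sumOver-cong-∈ (words g) extensions)
    where
    extensions : ∀ u → u ∈ words g →
      sumOver (words (q * g)) (λ w → 𝟙 (closedWord? (u ++ w)) *ᶻ 𝟙 (isPeriod? Fin._≟_ g (u ++ w))) ≡ 𝟙 (closedWord? u)
    extensions u u∈ = trans (sumOver-cong-∈ (words (q * g)) onlyPower)
      (trans (sumOver-*ˡ (words (q * g)) (𝟙 (closedWord? u)) _)
      (trans (cong (𝟙 (closedWord? u) *ᶻ_) (sumOver-words-𝟙≟ (q * g) (power u q)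
               (trans (length-power u q) (cong (q *_) len-u))))
             (ℤP.*-identityʳ _)))
      where
      len-u : length u ≡ g
      len-u = length-∈-words g u u∈
      onlyPower : ∀ w → w ∈ words (q * g) →
        𝟙 (closedWord? (u ++ w)) *ᶻ 𝟙 (isPeriod? Fin._≟_ g (u ++ w)) ≡ 𝟙 (closedWord? u) *ᶻ 𝟙 (w ≟ʷ power u q)
      onlyPower w w∈ with w ≟ʷ power u q
      ... | yes refl = cong₂ _*ᶻ_ (𝟙-closed-power u q (subst (0 <_) (sym len-u) 0<g))
          (𝟙-yes (isPeriod? Fin._≟_ g (u ++ power u q)) (subst (λ k → IsPeriod k (u ++ power u q)) len-u (isPeriod-power u (suc q))))
      ... | no w≢ = trans (cong (𝟙 (closedWord? (u ++ w)) *ᶻ_) (𝟙-no (isPeriod? Fin._≟_ g (u ++ w))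
            (λ pg → w≢ (isPeriod-++⇒power q u w (trans (length-∈-words (q * g) w w∈) (cong (q *_) (sym len-u)))
                          (subst (λ k → IsPeriod k (u ++ w)) (sym len-u) pg)))))
          (trans (ℤP.*-zeroʳ (𝟙 (closedWord? (u ++ w)))) (sym (ℤP.*-zeroʳ (𝟙 (closedWord? u)))))

  module WalkCount (0<d : 0 < d) (d<n : d < n) where

    [c+s]%n≡c%n⇒n∣s : ∀ c s → (c + s) % n ≡ c % n → n ∣ s
    [c+s]%n≡c%n⇒n∣s c s e = ℕD.∣m+n∣m⇒∣n (subst (n ∣_) (sym shifted) (ℕD.n∣m*n ((c + s) / n))) (ℕD.n∣m*n (c / n))
      where
      shifted : (c / n) * n + s ≡ ((c + s) / n) * n
      shifted = ℕP.+-cancelˡ-≡ (c % n) _ _ (trans (sym (trans (cong (_+ s) (ℕDM.m≡m%n+[m/n]*n c n)) (ℕP.+-assoc (c % n) _ s)))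
                  (trans (ℕDM.m≡m%n+[m/n]*n (c + s) n) (cong (_+ ((c + s) / n) * n) e)))

    [c%n+t]%n≡[c+t]%n : ∀ c t → (c % n + t) % n ≡ (c + t) % n
    [c%n+t]%n≡[c+t]%n c t = trans (ℕDM.%-distribˡ-+ (c % n) t n)
      (trans (cong (λ z → (z + t % n) % n) (ℕDM.m%n%n≡m%n c n)) (sym (ℕDM.%-distribˡ-+ c t n)))

    lands : ℕ → Fin n → ℤ
    lands s y = 𝟙 (s % n ℕP.≟ toℕ y)

    -- walks of m steps from c to y, counted by their number j of steps of length a₁ + d
    binomialWalks : ℕ → ℕ → Fin n → ℤ
    binomialWalks m c y = ∑< (suc m) (λ j → + (m C j) *ᶻ lands (c + m * a₁ + j * d) y)

    binomialWalks-% : ∀ m c y → binomialWalks m (c % n) y ≡ binomialWalks m c y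
    binomialWalks-% m c y = ∑<-cong (suc m) (λ j _ → cong (+ (m C j) *ᶻ_)
      (𝟙-cong ((c % n + m * a₁ + j * d) % n ℕP.≟ toℕ y) ((c + m * a₁ + j * d) % n ℕP.≟ toℕ y)
              (trans (sym (reduce j))) (trans (reduce j))))
      where
      reduce : ∀ j → (c % n + m * a₁ + j * d) % n ≡ (c + m * a₁ + j * d) % n
      reduce j = trans (cong (_% n) (ℕP.+-assoc (c % n) (m * a₁) (j * d)))
        (trans ([c%n+t]%n≡[c+t]%n c (m * a₁ + j * d)) (cong (_% n) (sym (ℕP.+-assoc c (m * a₁) (j * d)))))

    binomialWalks-0 : ∀ c y → binomialWalks 0 c y ≡ lands c y
    binomialWalks-0 c y = trans (ℤP.+-identityʳ _) (trans (ℤP.*-identityˡ _)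
      (cong (λ s → lands s y) (trans (ℕP.+-identityʳ (c + 0)) (ℕP.+-identityʳ c))))

    binomialWalks-suc : ∀ k c y → binomialWalks (suc k) c y ≡ binomialWalks k (c + a₁) y +ᶻ binomialWalks k (c + a₁ + d) y
    binomialWalks-suc k c y = trans (cong (f 0 +ᶻ_) (trans pascal (cong₂ _+ᶻ_ longFirst dropTop)))
      (trans (x+[y+z]≡[x+z]+y (f 0) (binomialWalks k (c + a₁ + d) y) shortRest)
             (cong (_+ᶻ binomialWalks k (c + a₁ + d) y) (sym shortFirst)))
      where
      at : ℕ → ℤ
      at j = lands (c + suc k * a₁ + j * d) y
      f : ℕ → ℤ
      f j = + (suc k C j) *ᶻ at j
      shortRest = ∑< k (λ j → + (k C suc j) *ᶻ at (suc j))
      pascal : ∑< (suc k) (f ∘ suc) ≡ ∑< (suc k) (λ j → + (k C j) *ᶻ at (suc j)) +ᶻ ∑< (suc k) (λ j → + (k C suc j) *ᶻ at (suc j))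
      pascal = trans (∑<-cong (suc k) (λ j _ → trans (cong (λ z → + z *ᶻ at (suc j)) (sym (ℕC.nCk+nC[k+1]≡[n+1]C[k+1] k j)))
                       (ℤP.*-distribʳ-+ (at (suc j)) (+ (k C j)) (+ (k C suc j)))))
                     (∑<-+ (suc k) (λ j → + (k C j) *ᶻ at (suc j)) (λ j → + (k C suc j) *ᶻ at (suc j)))
      longFirst : ∑< (suc k) (λ j → + (k C j) *ᶻ at (suc j)) ≡ binomialWalks k (c + a₁ + d) y
      longFirst = ∑<-cong (suc k) (λ j _ → cong (λ s → + (k C j) *ᶻ lands s y) (sym (long-index j)))
        where
        long-index : ∀ j → c + a₁ + d + k * a₁ + j * d ≡ c + suc k * a₁ + suc j * d
        long-index j = solve 5 (λ c a k e j → c :+ a :+ e :+ k :* a :+ j :* e := c :+ (con 1 :+ k) :* a :+ (con 1 :+ j) :* e)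
          refl c a₁ k d j
          where open ℕSolver.+-*-Solver
      dropTop : ∑< (suc k) (λ j → + (k C suc j) *ᶻ at (suc j)) ≡ shortRest
      dropTop = trans (∑<-snoc k _) (trans (cong (shortRest +ᶻ_)
        (cong (λ z → + z *ᶻ at (suc k)) (ℕC.k>n⇒nCk≡0 (ℕP.n<1+n k)))) (ℤP.+-identityʳ shortRest))
      shortFirst : binomialWalks k (c + a₁) y ≡ f 0 +ᶻ shortRest
      shortFirst = cong₂ _+ᶻ_ (cong (λ s → + 1 *ᶻ lands s y) (short-index 0))
                              (∑<-cong k (λ j _ → cong (λ s → + (k C suc j) *ᶻ lands s y) (short-index (suc j))))
        where
        short-index : ∀ j → c + a₁ + k * a₁ + j * d ≡ c + suc k * a₁ + j * d
        short-index j = solve 5 (λ c a k e j → c :+ a :+ k :* a :+ j :* e := c :+ (con 1 :+ k) :* a :+ j :* e)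
          refl c a₁ k d j
          where open ℕSolver.+-*-Solver

    -- the two neighbours of x are distinct since 0 < d < n
    𝟙-bond : ∀ x z → 𝟙 (bond? x z) ≡ lands (toℕ x + a₁) z +ᶻ lands (toℕ x + a₁ + d) z
    𝟙-bond x z = trans (𝟙-⊎ (toℕ z ℕP.≟ (toℕ x + a₁) % n) (toℕ z ℕP.≟ (toℕ x + (a₁ + d)) % n) distinct)
      (cong₂ _+ᶻ_ (𝟙-cong (toℕ z ℕP.≟ (toℕ x + a₁) % n) ((toℕ x + a₁) % n ℕP.≟ toℕ z) sym sym)
                  (𝟙-cong (toℕ z ℕP.≟ (toℕ x + (a₁ + d)) % n) ((toℕ x + a₁ + d) % n ℕP.≟ toℕ z)
                    (λ e → trans (cong (_% n) (ℕP.+-assoc (toℕ x) a₁ d)) (sym e))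
                    (λ e → sym (trans (cong (_% n) (sym (ℕP.+-assoc (toℕ x) a₁ d))) e))))
      where
      distinct : toℕ z ≡ (toℕ x + a₁) % n → toℕ z ≡ (toℕ x + (a₁ + d)) % n → ⊥
      distinct short long = ℕP.<-irrefl refl (ℕP.<-≤-trans d<n (ℕD.∣⇒≤ {{ℕ.>-nonZero 0<d}}
        ([c+s]%n≡c%n⇒n∣s (toℕ x + a₁) d (trans (cong (_% n) (ℕP.+-assoc (toℕ x) a₁ d)) (trans (sym long) short)))))

    walks : ℕ → Fin n → Fin n → ℤ
    walks m x y = sumOver (words m) (λ v → 𝟙 (walk? bond? x v y))

    walks≡binomialWalks : ∀ m x y → walks m x y ≡ binomialWalks (suc m) (toℕ x) y
    walks≡binomialWalks zero x y = trans (ℤP.+-identityʳ _) (trans (𝟙-bond x y)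
      (sym (trans (binomialWalks-suc 0 (toℕ x) y) (cong₂ _+ᶻ_ (binomialWalks-0 _ y) (binomialWalks-0 _ y)))))
    walks≡binomialWalks (suc m) x y = begin
      walks (suc m) x y
        ≡⟨ sumOver-words-suc m _ ⟩
      sumOver (allFin n) (λ z → sumOver (words m) (λ v → 𝟙 (walk? bond? x (z ∷ v) y)))
        ≡⟨ sumOver-cong (allFin n) firstStep ⟩
      sumOver (allFin n) (λ z → (𝟙 (short ℕP.≟ toℕ z) +ᶻ 𝟙 (long ℕP.≟ toℕ z)) *ᶻ rest (toℕ z))
        ≡⟨ sumOver-allFin n (λ i → (𝟙 (short ℕP.≟ i) +ᶻ 𝟙 (long ℕP.≟ i)) *ᶻ rest i) ⟩
      ∑< n (λ i → (𝟙 (short ℕP.≟ i) +ᶻ 𝟙 (long ℕP.≟ i)) *ᶻ rest i)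
        ≡⟨ trans (∑<-cong n (λ i _ → ℤP.*-distribʳ-+ (rest i) (𝟙 (short ℕP.≟ i)) (𝟙 (long ℕP.≟ i)))) (∑<-+ n _ _) ⟩
      ∑< n (λ i → 𝟙 (short ℕP.≟ i) *ᶻ rest i) +ᶻ ∑< n (λ i → 𝟙 (long ℕP.≟ i) *ᶻ rest i)
        ≡⟨ cong₂ _+ᶻ_ (∑<-delta n short rest (ℕDM.m%n<n _ n)) (∑<-delta n long rest (ℕDM.m%n<n _ n)) ⟩
      rest short +ᶻ rest long
        ≡⟨ cong₂ _+ᶻ_ (binomialWalks-% (suc m) _ y) (binomialWalks-% (suc m) _ y) ⟩
      binomialWalks (suc m) (toℕ x + a₁) y +ᶻ binomialWalks (suc m) (toℕ x + a₁ + d) y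
        ≡⟨ sym (binomialWalks-suc (suc m) (toℕ x) y) ⟩
      binomialWalks (suc (suc m)) (toℕ x) y ∎
      where
      open ≡-Reasoning
      short = (toℕ x + a₁) % n
      long = (toℕ x + a₁ + d) % n
      rest : ℕ → ℤ
      rest c = binomialWalks (suc m) c y
      firstStep : ∀ z → sumOver (words m) (λ v → 𝟙 (walk? bond? x (z ∷ v) y))
                      ≡ (𝟙 (short ℕP.≟ toℕ z) +ᶻ 𝟙 (long ℕP.≟ toℕ z)) *ᶻ rest (toℕ z)
      firstStep z = trans (sumOver-cong (words m) (λ v → 𝟙-× (bond? x z) (walk? bond? z v y)))
        (trans (sumOver-*ˡ (words m) (𝟙 (bond? x z)) _) (cong₂ _*ᶻ_ (𝟙-bond x z) (walks≡binomialWalks m z y)))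

    sumOver-closed : ∀ m → sumOver (words (suc m)) (λ u → 𝟙 (closedWord? u)) ≡ + n *ᶻ closedWalksFrom n a₁ d (suc m)
    sumOver-closed m = trans (sumOver-words-suc m _) (trans (sumOver-cong (allFin n) (λ x → trans (walks≡binomialWalks m x x) (returns x)))
      (trans (sumOver-const (allFin n) _) (cong (λ k → + k *ᶻ closedWalksFrom n a₁ d (suc m)) (LP.length-tabulate {n = n} (λ i → i)))))
      where
      returns : ∀ x → binomialWalks (suc m) (toℕ x) x ≡ closedWalksFrom n a₁ d (suc m)
      returns x = ∑<-cong (suc (suc m)) (λ j _ → cong (+ (suc m C j) *ᶻ_)
        (𝟙-cong ((toℕ x + suc m * a₁ + j * d) % n ℕP.≟ toℕ x) (n ∣? suc m * a₁ + j * d)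
          (λ e → [c+s]%n≡c%n⇒n∣s (toℕ x) _ (trans (cong (_% n) (sym (ℕP.+-assoc (toℕ x) _ _))) (trans e (sym (ℕDM.m<n⇒m%n≡m (FinP.toℕ<n x))))))
          (λ n∣ → trans (cong (_% n) (ℕP.+-assoc (toℕ x) _ _)) (trans (ℕDM.%-remove-+ʳ (toℕ x) n∣) (ℕDM.m<n⇒m%n≡m (FinP.toℕ<n x))))))

    sumOver-closed-isPeriod-cofactor : ∀ l i → 0 < l → suc i ∣ l →
      sumOver (words l) (λ v → 𝟙 (closedWord? v) *ᶻ 𝟙 (isPeriod? Fin._≟_ (l / suc i) v)) ≡ + n *ᶻ closedWalksFrom n a₁ d (l / suc i)
    sumOver-closed-isPeriod-cofactor l i 0<l (divides zero l≡0) = ⊥-elim (ℕP.<-irrefl (sym l≡0) 0<l)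
    sumOver-closed-isPeriod-cofactor l i 0<l (divides (suc k) l≡Kω) = begin
      sumOver (words l) (λ v → 𝟙 (closedWord? v) *ᶻ 𝟙 (isPeriod? Fin._≟_ (l / suc i) v))
        ≡⟨ cong₂ (λ m g → sumOver (words m) (λ v → 𝟙 (closedWord? v) *ᶻ 𝟙 (isPeriod? Fin._≟_ g v)))
                 (trans l≡Kω (ℕP.*-comm (suc k) (suc i))) l/ω≡K ⟩
      sumOver (words (suc i * suc k)) (λ v → 𝟙 (closedWord? v) *ᶻ 𝟙 (isPeriod? Fin._≟_ (suc k) v))
        ≡⟨ sumOver-closed-isPeriod (suc k) i (s≤s z≤n) ⟩
      sumOver (words (suc k)) (λ u → 𝟙 (closedWord? u))
        ≡⟨ sumOver-closed k ⟩
      + n *ᶻ closedWalksFrom n a₁ d (suc k)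
        ≡⟨ cong (λ g → + n *ᶻ closedWalksFrom n a₁ d g) (sym l/ω≡K) ⟩
      + n *ᶻ closedWalksFrom n a₁ d (l / suc i) ∎
      where
      open ≡-Reasoning
      l/ω≡K : l / suc i ≡ suc k
      l/ω≡K = trans (ℕDM./-congˡ l≡Kω) (ℕDM.m*n/n≡m (suc k) (suc i))

    sumOver-primitiveClosed : ∀ l → 0 < l → sumOver (words l) (λ v → 𝟙 (primitiveClosed? v))
      ≡ + n *ᶻ ∑< l (λ i → 𝟙 (suc i ∣? l) *ᶻ (μ (suc i) *ᶻ closedWalksFrom n a₁ d (l / suc i)))
    sumOver-primitiveClosed l 0<l = begin
      sumOver (words l) (λ v → 𝟙 (primitiveClosed? v))
        ≡⟨ sumOver-cong-∈ (words l) möbius ⟩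
      sumOver (words l) (λ v → ∑< l (λ i → 𝟙 (closedWord? v) *ᶻ periodTerm i v))
        ≡⟨ sym (∑<-sumOver l (words l) (λ i v → 𝟙 (closedWord? v) *ᶻ periodTerm i v)) ⟩
      ∑< l (λ i → sumOver (words l) (λ v → 𝟙 (closedWord? v) *ᶻ periodTerm i v))
        ≡⟨ ∑<-cong l (λ i _ → perDivisor i) ⟩
      ∑< l (λ i → + n *ᶻ (𝟙 (suc i ∣? l) *ᶻ (μ (suc i) *ᶻ closedWalksFrom n a₁ d (l / suc i))))
        ≡⟨ ∑<-*ˡ l (+ n) _ ⟩
      + n *ᶻ ∑< l (λ i → 𝟙 (suc i ∣? l) *ᶻ (μ (suc i) *ᶻ closedWalksFrom n a₁ d (l / suc i))) ∎
      where
      open ≡-Reasoning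
      periodTerm : ℕ → List (Fin n) → ℤ
      periodTerm i v = 𝟙 (suc i ∣? l) *ᶻ (𝟙 (isPeriod? Fin._≟_ (l / suc i) v) *ᶻ μ (suc i))
      möbius : ∀ v → v ∈ words l → 𝟙 (primitiveClosed? v) ≡ ∑< l (λ i → 𝟙 (closedWord? v) *ᶻ periodTerm i v)
      möbius v v∈ = trans (𝟙-× (closedWord? v) (aperiodic? Fin._≟_ v))
        (trans (cong (𝟙 (closedWord? v) *ᶻ_) (𝟙-aperiodic Fin._≟_ l v 0<l (length-∈-words l v v∈)))
               (sym (∑<-*ˡ l (𝟙 (closedWord? v)) (λ i → periodTerm i v))))
      perDivisor : ∀ i → sumOver (words l) (λ v → 𝟙 (closedWord? v) *ᶻ periodTerm i v)
                       ≡ + n *ᶻ (𝟙 (suc i ∣? l) *ᶻ (μ (suc i) *ᶻ closedWalksFrom n a₁ d (l / suc i)))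
      perDivisor i with suc i ∣? l
      ... | no _ = trans (sumOver-zero (words l) _ (λ v → ℤP.*-zeroʳ (𝟙 (closedWord? v)))) (sym (ℤP.*-zeroʳ (+ n)))
      ... | yes ω∣l = begin
        sumOver (words l) (λ v → 𝟙 (closedWord? v) *ᶻ (+ 1 *ᶻ (𝟙 (isPeriod? Fin._≟_ (l / suc i) v) *ᶻ μ (suc i))))
          ≡⟨ sumOver-cong (words l) (λ v → trans (cong (𝟙 (closedWord? v) *ᶻ_) (ℤP.*-identityˡ _))
               (trans (sym (ℤP.*-assoc (𝟙 (closedWord? v)) _ (μ (suc i)))) (ℤP.*-comm _ (μ (suc i))))) ⟩
        sumOver (words l) (λ v → μ (suc i) *ᶻ (𝟙 (closedWord? v) *ᶻ 𝟙 (isPeriod? Fin._≟_ (l / suc i) v)))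
          ≡⟨ sumOver-*ˡ (words l) (μ (suc i)) _ ⟩
        μ (suc i) *ᶻ sumOver (words l) (λ v → 𝟙 (closedWord? v) *ᶻ 𝟙 (isPeriod? Fin._≟_ (l / suc i) v))
          ≡⟨ cong (μ (suc i) *ᶻ_) (sumOver-closed-isPeriod-cofactor l i 0<l ω∣l) ⟩
        μ (suc i) *ᶻ (+ n *ᶻ closedWalksFrom n a₁ d (l / suc i))
          ≡⟨ x*[y*z]≡y*[x*z] (μ (suc i)) (+ n) _ ⟩
        + n *ᶻ (μ (suc i) *ᶻ closedWalksFrom n a₁ d (l / suc i))
          ≡⟨ cong (+ n *ᶻ_) (sym (ℤP.*-identityˡ _)) ⟩
        + n *ᶻ (+ 1 *ᶻ (μ (suc i) *ᶻ closedWalksFrom n a₁ d (l / suc i))) ∎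

-- Rearranging the formula

module _ (n A : ℕ) {{_ : NonZero n}} where

  private
    n∸1<n : n ∸ 1 < n
    n∸1<n = ℕP.∸-monoʳ-< {n} {1} {0} (s≤s z≤n) (ℕ.>-nonZero⁻¹ n)

  ≤*⇒ceilDiv≤ : ∀ m → A ≤ m * n → ceilDiv A n ≤ m
  ≤*⇒ceilDiv≤ m A≤mn = ℕP.≤-pred (ℕDM.m<n*o⇒m/o<n {A + (n ∸ 1)} {suc m} {n}
    (ℕP.≤-<-trans (ℕP.+-monoˡ-≤ (n ∸ 1) A≤mn)
      (subst (m * n + (n ∸ 1) <_) (ℕP.+-comm (m * n) n) (ℕP.+-monoʳ-< (m * n) n∸1<n))))

  ceilDiv≤⇒≤* : ∀ m → ceilDiv A n ≤ m → A ≤ m * n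
  ceilDiv≤⇒≤* m lo≤m = ℕP.≤-trans A≤lo*n (ℕP.*-monoˡ-≤ n lo≤m)
    where
    A≤lo*n : A ≤ ceilDiv A n * n
    A≤lo*n = ℕP.+-cancelʳ-≤ (n ∸ 1) A _ (begin
      A + (n ∸ 1)                                   ≡⟨ ℕDM.m≡m%n+[m/n]*n (A + (n ∸ 1)) n ⟩
      (A + (n ∸ 1)) % n + ceilDiv A n * n           ≤⟨ ℕP.+-monoˡ-≤ _ (ℕP.<⇒≤pred (ℕDM.m%n<n (A + (n ∸ 1)) n)) ⟩
      (n ∸ 1) + ceilDiv A n * n                     ≡⟨ ℕP.+-comm (n ∸ 1) _ ⟩
      ceilDiv A n * n + (n ∸ 1)                     ∎)
      where open ℕP.≤-Reasoning

∑<-multiples-≤ : ∀ m (f : ℕ → ℤ) M →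
  ∑< (suc M) (λ y → 𝟙 (suc m ∣? y) *ᶻ f y) ≡ ∑< (suc (M / suc m)) (λ e → f (e * suc m))
∑<-multiples-≤ m f M = cong₂ _+ᶻ_ (trans (cong (_*ᶻ f 0) (𝟙-yes (suc m ∣? 0) (ℕD._∣0 (suc m)))) (ℤP.*-identityˡ (f 0)))
    (trans (cong (λ k → ∑< k g) M≡) (trans (∑<-split (q * ω) (M % ω) g)
       (trans (cong₂ _+ᶻ_ (∑<-multiples m f q) (∑<-zero (M % ω) _ remainder)) (ℤP.+-identityʳ _))))
  where
  ω = suc m
  q = M / ω
  g : ℕ → ℤ
  g i = 𝟙 (ω ∣? suc i) *ᶻ f (suc i)
  M≡ : M ≡ q * ω + M % ω
  M≡ = trans (ℕDM.m≡m%n+[m/n]*n M ω) (ℕP.+-comm (M % ω) (q * ω))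
  remainder : ∀ i → i < M % ω → g (q * ω + i) ≡ + 0
  remainder i i<r = cong (_*ᶻ f (suc (q * ω + i))) (𝟙-no (ω ∣? suc (q * ω + i)) (λ ω∣ →
    ℕD.>⇒∤ (ℕP.≤-trans (s≤s i<r) (ℕDM.m%n<n M ω))
      (ℕD.∣m+n∣m⇒∣n (subst (ω ∣_) (sym (ℕP.+-suc (q * ω) i)) ω∣) (ℕD.n∣m*n q))))

binomFrac-scale : ∀ a x i d′ → binomFrac a (x * suc i) (suc i * suc d′) ≡ binomFrac a x (suc d′)
binomFrac-scale a x i d′ = if-else-0-cong (suc i * suc d′ ∣? x * suc i) (suc d′ ∣? x)
  (λ h → ℕD.*-cancelˡ-∣ (suc i) (subst (suc i * suc d′ ∣_) (ℕP.*-comm x (suc i)) h))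
  (λ h → subst (suc i * suc d′ ∣_) (ℕP.*-comm (suc i) x) (ℕD.*-monoʳ-∣ (suc i) h))
  (cong (a C_) (trans (ℕDM./-congˡ (ℕP.*-comm x (suc i))) (ℕDM.m*n/m*o≡n/o (suc i) x (suc d′))))

module Formula (n′ a₁ d′ : ℕ) where

  n = suc n′
  d = suc d′

  -- closed walks with j long steps exist iff n ∣ a₁ K + j d; writing a₁ K + j d = m n turns the sum over j into the formula's sum over m
  closedWalksFrom-as-multiples : ∀ K → let Y = a₁ * K + K * d in
    ∑< (suc (Y / n)) (λ e → 𝟙 (a₁ * K ℕP.≤? e * n) *ᶻ + binomFrac K (e * n ∸ a₁ * K) d) ≡ closedWalksFrom n a₁ d K
  closedWalksFrom-as-multiples K = begin
    ∑< (suc (Y / n)) (λ e → term (e * n))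
      ≡⟨ sym (∑<-multiples-≤ n′ term Y) ⟩
    ∑< (suc Y) (λ y → 𝟙 (n ∣? y) *ᶻ term y)
      ≡⟨ cong (λ k → ∑< k (λ y → 𝟙 (n ∣? y) *ᶻ term y)) (sym (ℕP.+-suc (a₁ * K) (K * d))) ⟩
    ∑< (a₁ * K + suc (K * d)) (λ y → 𝟙 (n ∣? y) *ᶻ term y)
      ≡⟨ ∑<-split (a₁ * K) (suc (K * d)) _ ⟩
    ∑< (a₁ * K) (λ y → 𝟙 (n ∣? y) *ᶻ term y) +ᶻ ∑< (suc (K * d)) (λ z → 𝟙 (n ∣? a₁ * K + z) *ᶻ term (a₁ * K + z))
      ≡⟨ cong₂ _+ᶻ_ (∑<-zero (a₁ * K) _ belowStart) (∑<-cong (suc (K * d)) (λ z _ → shifted z)) ⟩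
    + 0 +ᶻ ∑< (suc (K * d)) (λ z → 𝟙 (d ∣? z) *ᶻ (𝟙 (n ∣? a₁ * K + z) *ᶻ + (K C (z / d))))
      ≡⟨ ℤP.+-identityˡ _ ⟩
    ∑< (suc (K * d)) (λ z → 𝟙 (d ∣? z) *ᶻ (𝟙 (n ∣? a₁ * K + z) *ᶻ + (K C (z / d))))
      ≡⟨ ∑<-multiples-≤ d′ (λ z → 𝟙 (n ∣? a₁ * K + z) *ᶻ + (K C (z / d))) (K * d) ⟩
    ∑< (suc (K * d / d)) (λ j → 𝟙 (n ∣? a₁ * K + j * d) *ᶻ + (K C (j * d / d)))
      ≡⟨ cong (λ k → ∑< (suc k) (λ j → 𝟙 (n ∣? a₁ * K + j * d) *ᶻ + (K C (j * d / d)))) (ℕDM.m*n/n≡m K d) ⟩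
    ∑< (suc K) (λ j → 𝟙 (n ∣? a₁ * K + j * d) *ᶻ + (K C (j * d / d)))
      ≡⟨ ∑<-cong (suc K) (λ j _ → summand j) ⟩
    closedWalksFrom n a₁ d K ∎
    where
    open ≡-Reasoning
    Y = a₁ * K + K * d
    term : ℕ → ℤ
    term y = 𝟙 (a₁ * K ℕP.≤? y) *ᶻ + binomFrac K (y ∸ a₁ * K) d
    belowStart : ∀ y → y < a₁ * K → 𝟙 (n ∣? y) *ᶻ term y ≡ + 0
    belowStart y y< = trans (cong (λ z → 𝟙 (n ∣? y) *ᶻ (z *ᶻ + binomFrac K (y ∸ a₁ * K) d)) (𝟙-no (a₁ * K ℕP.≤? y) (ℕP.<⇒≱ y<)))
                            (ℤP.*-zeroʳ (𝟙 (n ∣? y)))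
    shifted : ∀ z → 𝟙 (n ∣? a₁ * K + z) *ᶻ term (a₁ * K + z) ≡ 𝟙 (d ∣? z) *ᶻ (𝟙 (n ∣? a₁ * K + z) *ᶻ + (K C (z / d)))
    shifted z = trans (cong (𝟙 (n ∣? a₁ * K + z) *ᶻ_)
        (trans (cong₂ _*ᶻ_ (𝟙-yes (a₁ * K ℕP.≤? a₁ * K + z) (ℕP.m≤m+n (a₁ * K) z))
                           (trans (cong (λ w → + binomFrac K w d) (ℕP.m+n∸m≡n (a₁ * K) z)) (if-else-0 (d ∣? z) (K C (z / d)))))
               (ℤP.*-identityˡ _)))
      (x*[y*z]≡y*[x*z] (𝟙 (n ∣? a₁ * K + z)) (𝟙 (d ∣? z)) (+ (K C (z / d))))
    summand : ∀ j → 𝟙 (n ∣? a₁ * K + j * d) *ᶻ + (K C (j * d / d)) ≡ + (K C j) *ᶻ 𝟙 (n ∣? K * a₁ + j * d)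
    summand j = trans (cong₂ _*ᶻ_ (cong (λ w → 𝟙 (n ∣? w + j * d)) (ℕP.*-comm a₁ K)) (cong (λ w → + (K C w)) (ℕDM.m*n/n≡m j d)))
                      (ℤP.*-comm (𝟙 (n ∣? K * a₁ + j * d)) (+ (K C j)))

  module _ (l : ℕ) where

    hi lo : ℕ
    hi = (d + a₁) * l / n
    lo = ceilDiv (a₁ * l) n

    binomialTerm : ℕ → ℕ → ℤ
    binomialTerm i m = + binomFrac (l / suc i) (m * n ∸ a₁ * l) (suc i * d)

    inRange : ℕ → ℤ
    inRange m = 𝟙 (a₁ * l ℕP.≤? m * n)

    innerTerm : ℕ → ℕ → ℤ
    innerTerm i m = 𝟙 (suc i ∣? m) *ᶻ (𝟙 (suc i ∣? l) *ᶻ (μ (suc i) *ᶻ binomialTerm i m))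

    innerSum-as-∑< : ∀ m → innerSum n l a₁ d m ≡ ∑< l (λ i → innerTerm i m)
    innerSum-as-∑< m = trans (foldr-applyUpTo l _) (∑<-cong l (λ i _ → if-∧-else-0 (suc i ∣? m) (suc i ∣? l) _))

    sumRange-as-∑< : (g : ℕ → ℤ) → sumRange lo hi g ≡ ∑< (suc hi) (λ m → inRange m *ᶻ g m)
    sumRange-as-∑< g = trans (foldr-applyUpTo (suc hi ∸ lo) _) (sym (begin
      ∑< (suc hi) h                                 ≡⟨ cong (λ k → ∑< k h) (sym (ℕP.m+[n∸m]≡n lo≤1+hi)) ⟩
      ∑< (lo + (suc hi ∸ lo)) h                     ≡⟨ ∑<-split lo (suc hi ∸ lo) h ⟩
      ∑< lo h +ᶻ ∑< (suc hi ∸ lo) (λ t → h (lo + t)) ≡⟨ cong₂ _+ᶻ_ (∑<-zero lo h belowLo) (∑<-cong (suc hi ∸ lo) aboveLo) ⟩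
      + 0 +ᶻ ∑< (suc hi ∸ lo) (λ t → g (lo + t))     ≡⟨ ℤP.+-identityˡ _ ⟩
      ∑< (suc hi ∸ lo) (λ t → g (lo + t))            ∎))
      where
      open ≡-Reasoning
      h : ℕ → ℤ
      h m = inRange m *ᶻ g m
      A≤[1+hi]n : a₁ * l ≤ suc hi * n
      A≤[1+hi]n = ℕP.≤-trans (ℕP.≤-trans (ℕP.m≤n+m (a₁ * l) (d * l)) (ℕP.≤-reflexive (sym (ℕP.*-distribʳ-+ l d a₁))))
        (ℕP.<⇒≤ (ℕP.≤-<-trans (ℕP.≤-reflexive (ℕDM.m≡m%n+[m/n]*n ((d + a₁) * l) n))
                               (ℕP.+-monoˡ-< (hi * n) (ℕDM.m%n<n ((d + a₁) * l) n))))
      lo≤1+hi : lo ≤ suc hi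
      lo≤1+hi = ≤*⇒ceilDiv≤ n (a₁ * l) (suc hi) A≤[1+hi]n
      belowLo : ∀ m → m < lo → h m ≡ + 0
      belowLo m m<lo = cong (_*ᶻ g m) (𝟙-no (a₁ * l ℕP.≤? m * n) (λ A≤ → ℕP.<⇒≱ m<lo (≤*⇒ceilDiv≤ n (a₁ * l) m A≤)))
      aboveLo : ∀ t → t < suc hi ∸ lo → h (lo + t) ≡ g (lo + t)
      aboveLo t _ = trans (cong (_*ᶻ g (lo + t)) (𝟙-yes (a₁ * l ℕP.≤? (lo + t) * n) (ceilDiv≤⇒≤* n (a₁ * l) (lo + t) (ℕP.m≤m+n lo t))))
                          (ℤP.*-identityˡ _)

    -- For ω ∣ l the terms with ω ∣ m are the multiples m = e ω, and l = K ω scales everything down by ω.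
    multiplesSum : ∀ i K → l ≡ K * suc i →
      ∑< (suc hi) (λ m → 𝟙 (suc i ∣? m) *ᶻ (inRange m *ᶻ binomialTerm i m)) ≡ closedWalksFrom n a₁ d K
    multiplesSum i K l≡Kω = begin
      ∑< (suc hi) (λ m → 𝟙 (ω ∣? m) *ᶻ (inRange m *ᶻ binomialTerm i m))
        ≡⟨ ∑<-multiples-≤ i (λ m → inRange m *ᶻ binomialTerm i m) hi ⟩
      ∑< (suc (hi / ω)) (λ e → inRange (e * ω) *ᶻ binomialTerm i (e * ω))
        ≡⟨ cong (λ k → ∑< (suc k) (λ e → inRange (e * ω) *ᶻ binomialTerm i (e * ω))) hi/ω≡ ⟩
      ∑< (suc (Y / n)) (λ e → inRange (e * ω) *ᶻ binomialTerm i (e * ω))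
        ≡⟨ ∑<-cong (suc (Y / n)) (λ e _ → scaled e) ⟩
      ∑< (suc (Y / n)) (λ e → 𝟙 (a₁ * K ℕP.≤? e * n) *ᶻ + binomFrac K (e * n ∸ a₁ * K) d)
        ≡⟨ closedWalksFrom-as-multiples K ⟩
      closedWalksFrom n a₁ d K ∎
      where
      open ≡-Reasoning
      ω = suc i
      Y = a₁ * K + K * d
      l/ω≡K : l / ω ≡ K
      l/ω≡K = trans (ℕDM./-congˡ l≡Kω) (ℕDM.m*n/n≡m K ω)
      hi/ω≡ : hi / ω ≡ Y / n
      hi/ω≡ = trans (ℕDM.m/n/o≡m/[n*o] ((d + a₁) * l) n ω) (trans (ℕDM./-congˡ total) (ℕDM.m*n/o*n≡m/o Y ω n))
        where
        total : (d + a₁) * l ≡ Y * ω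
        total = trans (cong ((d + a₁) *_) l≡Kω) (solve 4 (λ d a K w → (d :+ a) :* (K :* w) := (a :* K :+ K :* d) :* w) refl d a₁ K ω)
          where open ℕSolver.+-*-Solver
      scaled : ∀ e → inRange (e * ω) *ᶻ binomialTerm i (e * ω) ≡ 𝟙 (a₁ * K ℕP.≤? e * n) *ᶻ + binomFrac K (e * n ∸ a₁ * K) d
      scaled e = cong₂ _*ᶻ_
          (𝟙-cong (a₁ * l ℕP.≤? e * ω * n) (a₁ * K ℕP.≤? e * n)
            (λ le → ℕP.*-cancelʳ-≤ (a₁ * K) (e * n) ω (subst₂ _≤_ A≡ eωn≡ le))
            (λ le → subst₂ _≤_ (sym A≡) (sym eωn≡) (ℕP.*-monoˡ-≤ ω le)))
          (cong +_ (trans (cong (λ k → binomFrac k (e * ω * n ∸ a₁ * l) (ω * d)) l/ω≡K)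
            (trans (cong (λ x → binomFrac K x (ω * d)) diff≡) (binomFrac-scale K (e * n ∸ a₁ * K) i d′))))
        where
        eωn≡ : e * ω * n ≡ e * n * ω
        eωn≡ = trans (ℕP.*-assoc e ω n) (trans (cong (e *_) (ℕP.*-comm ω n)) (sym (ℕP.*-assoc e n ω)))
        A≡ : a₁ * l ≡ a₁ * K * ω
        A≡ = trans (cong (a₁ *_) l≡Kω) (sym (ℕP.*-assoc a₁ K ω))
        diff≡ : e * ω * n ∸ a₁ * l ≡ (e * n ∸ a₁ * K) * ω
        diff≡ = trans (cong₂ _∸_ eωn≡ A≡) (sym (ℕP.*-distribʳ-∸ ω (e * n) (a₁ * K)))

    multiplesSum-μ : ∀ i → ∑< (suc hi) (λ m → inRange m *ᶻ innerTerm i m)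
                         ≡ 𝟙 (suc i ∣? l) *ᶻ (μ (suc i) *ᶻ closedWalksFrom n a₁ d (l / suc i))
    multiplesSum-μ i with suc i ∣? l
    ... | no _ = ∑<-zero (suc hi) _ (λ m _ → trans (cong (inRange m *ᶻ_) (ℤP.*-zeroʳ (𝟙 (suc i ∣? m)))) (ℤP.*-zeroʳ (inRange m)))
    ... | yes (divides K l≡Kω) = begin
      ∑< (suc hi) (λ m → inRange m *ᶻ (𝟙 (suc i ∣? m) *ᶻ (+ 1 *ᶻ (μ (suc i) *ᶻ binomialTerm i m))))
        ≡⟨ ∑<-cong (suc hi) (λ m _ → reorder m) ⟩
      ∑< (suc hi) (λ m → μ (suc i) *ᶻ (𝟙 (suc i ∣? m) *ᶻ (inRange m *ᶻ binomialTerm i m)))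
        ≡⟨ ∑<-*ˡ (suc hi) (μ (suc i)) (λ m → 𝟙 (suc i ∣? m) *ᶻ (inRange m *ᶻ binomialTerm i m)) ⟩
      μ (suc i) *ᶻ ∑< (suc hi) (λ m → 𝟙 (suc i ∣? m) *ᶻ (inRange m *ᶻ binomialTerm i m))
        ≡⟨ cong (μ (suc i) *ᶻ_) (multiplesSum i K l≡Kω) ⟩
      μ (suc i) *ᶻ closedWalksFrom n a₁ d K
        ≡⟨ cong (λ k → μ (suc i) *ᶻ closedWalksFrom n a₁ d k) (sym (trans (ℕDM./-congˡ l≡Kω) (ℕDM.m*n/n≡m K (suc i)))) ⟩
      μ (suc i) *ᶻ closedWalksFrom n a₁ d (l / suc i)
        ≡⟨ sym (ℤP.*-identityˡ _) ⟩
      + 1 *ᶻ (μ (suc i) *ᶻ closedWalksFrom n a₁ d (l / suc i)) ∎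
      where
      open ≡-Reasoning
      reorder : ∀ m → inRange m *ᶻ (𝟙 (suc i ∣? m) *ᶻ (+ 1 *ᶻ (μ (suc i) *ᶻ binomialTerm i m)))
                    ≡ μ (suc i) *ᶻ (𝟙 (suc i ∣? m) *ᶻ (inRange m *ᶻ binomialTerm i m))
      reorder m = trans (cong (λ z → inRange m *ᶻ (𝟙 (suc i ∣? m) *ᶻ z)) (ℤP.*-identityˡ _))
        (trans (x*[y*z]≡y*[x*z] (inRange m) (𝟙 (suc i ∣? m)) _)
        (trans (cong (𝟙 (suc i ∣? m) *ᶻ_) (x*[y*z]≡y*[x*z] (inRange m) (μ (suc i)) _))
               (x*[y*z]≡y*[x*z] (𝟙 (suc i ∣? m)) (μ (suc i)) _)))

    formulaSum≡μ-sum : sumRange lo hi (innerSum n l a₁ d)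
      ≡ ∑< l (λ i → 𝟙 (suc i ∣? l) *ᶻ (μ (suc i) *ᶻ closedWalksFrom n a₁ d (l / suc i)))
    formulaSum≡μ-sum = begin
      sumRange lo hi (innerSum n l a₁ d)
        ≡⟨ sumRange-as-∑< (innerSum n l a₁ d) ⟩
      ∑< (suc hi) (λ m → inRange m *ᶻ innerSum n l a₁ d m)
        ≡⟨ ∑<-cong (suc hi) (λ m _ → trans (cong (inRange m *ᶻ_) (innerSum-as-∑< m)) (sym (∑<-*ˡ l (inRange m) (λ i → innerTerm i m)))) ⟩
      ∑< (suc hi) (λ m → ∑< l (λ i → inRange m *ᶻ innerTerm i m))
        ≡⟨ ∑<-swap (suc hi) l (λ m i → inRange m *ᶻ innerTerm i m) ⟩
      ∑< l (λ i → ∑< (suc hi) (λ m → inRange m *ᶻ innerTerm i m))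
        ≡⟨ ∑<-cong l (λ i _ → multiplesSum-μ i) ⟩
      ∑< l (λ i → 𝟙 (suc i ∣? l) *ᶻ (μ (suc i) *ᶻ closedWalksFrom n a₁ d (l / suc i))) ∎
      where open ≡-Reasoning

l*N≡n*S⇒N≡n/l*S : ∀ n l N (S : ℤ) .{{_ : NonZero l}} → + l *ᶻ + N ≡ + n *ᶻ S →
  + N ℚ./ 1 ≡ (+ n ℚ./ l) ℚ.* (S ℚ./ 1)
l*N≡n*S⇒N≡n/l*S n (suc l) N S eq = ℚP.toℚᵘ-injective
  (ℚᵘP.≃-trans (ℚP.toℚᵘ-fromℚᵘ (mkℚᵘ (+ N) 0))
  (ℚᵘP.≃-trans (*≡* cross-multiplied)
  (ℚᵘP.≃-sym (ℚᵘP.≃-trans (ℚP.toℚᵘ-homo-* (ℚ.fromℚᵘ (mkℚᵘ (+ n) l)) (ℚ.fromℚᵘ (mkℚᵘ S 0)))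
                          (ℚᵘP.*-cong (ℚP.toℚᵘ-fromℚᵘ (mkℚᵘ (+ n) l)) (ℚP.toℚᵘ-fromℚᵘ (mkℚᵘ S 0)))))))
  where
  cross-multiplied : + N *ᶻ + suc (l * 1) ≡ (+ n *ᶻ S) *ᶻ + 1
  cross-multiplied = trans (cong (λ k → + N *ᶻ + suc k) (ℕP.*-identityʳ l))
    (trans (ℤP.*-comm (+ N) (+ suc l)) (trans eq (sym (ℤP.*-identityʳ (+ n *ᶻ S)))))

theorem1 : (a₁ d n l : ℕ) → 0 < a₁ → 0 < d → (hn : a₁ + d < n) → (hl : 0 < l) →
    Σ ℕ λ N →
    NumPrimOrbits n a₁ d {{nz a₁ d hn}} l N ×
    + N ℚ./ 1 ≡ POformula n l a₁ d {{nz a₁ d hn}} {{ℕ.>-nonZero hl}}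
theorem1 a₁ (suc d′) (suc n′) l _ 0<d a₁+d<n 0<l =
  N , numPrimOrbits , l*N≡n*S⇒N≡n/l*S n l N S l*N≡n*S
  where
  n = suc n′
  open Circulant n a₁ (suc d′)
  open PrimitiveOrbits l 0<l
  open WalkCount 0<d (ℕP.≤-<-trans (ℕP.m≤n+m (suc d′) a₁) a₁+d<n)
  instance _ = ℕ.>-nonZero 0<l
  S = sumRange (ceilDiv (a₁ * l) n) ((suc d′ + a₁) * l / n) (innerSum n l a₁ (suc d′))
  l*N≡n*S : + l *ᶻ + N ≡ + n *ᶻ S
  l*N≡n*S = begin
    + l *ᶻ + N                                                   ≡⟨ ℤP.*-comm (+ l) (+ N) ⟩
    + N *ᶻ + l                                                   ≡⟨ sym sumOver-Q≡N*l ⟩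
    sumOver (words l) (λ v → 𝟙 (primitiveClosed? v))           ≡⟨ sumOver-primitiveClosed l 0<l ⟩
    + n *ᶻ ∑< l (λ i → 𝟙 (suc i ∣? l) *ᶻ (μ (suc i) *ᶻ closedWalksFrom n a₁ (suc d′) (l / suc i)))
                                                                 ≡⟨ cong (+ n *ᶻ_) (sym (Formula.formulaSum≡μ-sum n′ a₁ d′ l)) ⟩
    + n *ᶻ S                                                     ∎
    where open ≡-Reasoning
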